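{- Let $m,d\ge1$ with $d\mid m$, and let $h:=|d-m/d|$. Then $\Sigma_{m,d}$ is multiplicative. Moreover, with $\Sigma^{\mathrm{new}}_{m,d}:=\beta*\Sigma_{m,d}$, for all $N\ge1$, $$|\Sigma^{\mathrm{new}}_{m,d}(N)|\le\begin{cases}\dfrac{\sqrt N}{\pi_2(N)^2}&\text{if }h=0,\\[2mm] h\cdot4^{\omega(h)}&\text{if }h\ne0,\end{cases}\qquad\text{where }\pi_2(N)=\prod_{p\mid N}\Big(1+\frac1{p-1}\Big).$$
   Context: For $N\ge1$, $\Sigma_{m,d}(N)=\sum_\tau\phi(\gcd(\tau,N/\tau))$, the sum over positive divisors $\tau$ of $N$ with $\gcd(\tau,N/\tau)\mid(d-m/d)$ (every integer divides $0$), and $\phi$ is Euler's totient function. $\omega(h)$ is the number of distinct prime divisors of $h$. $\beta$ is the multiplicative function with $\beta(p)=-2$, $\beta(p^2)=1$, $\beta(p^r)=0$ for $r\ge3$, and $(\beta*f)(N)=\sum_{M\mid N}\beta(N/M)f(M)$. -}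

module Defs where

open import Data.Nat using (ℕ; zero; suc; _+_; _*_; _∸_; NonZero)
open import Data.Nat.DivMod using (_/_)
open import Data.Nat.Divisibility using (_∣?_)
open import Data.Nat.GCD using (gcd)
open import Data.Nat.Primality using (prime?)
open import Data.Bool using (Bool; true; false; if_then_else_; _∧_)
open import Data.List using (List; []; _∷_; map; filter; length; upTo; foldr)
open import Data.Integer as ℤ using (ℤ; +_; -[1+_]; ∣_∣)
open import Data.Rational as ℚ using (ℚ)
open import Relation.Nullary using (does)
open import Relation.Nullary.Decidable using (_×-dec_)
import Data.Nat as N

oneTo : ℕ → List ℕ
oneTo n = map suc (upTo n)

divSumℕ : ℕ → ((M : ℕ) → .{{NonZero M}} → ℕ) → ℕ
divSumℕ N f = foldr (λ k acc → (if does (suc k ∣? N) then f (suc k) else 0) + acc) 0 (upTo N)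

divSumℤ : ℕ → ((M : ℕ) → .{{NonZero M}} → ℤ) → ℤ
divSumℤ N f = foldr (λ k acc → (if does (suc k ∣? N) then f (suc k) else ℤ.0ℤ) ℤ.+ acc) ℤ.0ℤ (upTo N)

φ : ℕ → ℕ
φ n = length (filter (λ k → gcd k n N.≟ 1) (oneTo n))

primeDivisors : ℕ → List ℕ
primeDivisors n = filter (λ p → prime? p ×-dec (p ∣? n)) (oneTo n)

ω : ℕ → ℕ
ω h = length (primeDivisors h)

-- Σ_{m,d}(N) = Σ_{τ ∣ N, gcd(τ,N/τ) ∣ (d - m/d)} φ(gcd(τ, N/τ))
-- divisibility of the integer d - m/d by g is divisibility of its absolute value
Σmd : (m d : ℕ) → .{{NonZero d}} → ℕ → ℕ
Σmd m d N = divSumℕ N (λ τ → let g = gcd τ (N / τ) in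
  if does (g ∣? ∣ + d ℤ.- + (m / d) ∣) then φ g else 0)

-- p-adic valuation of n (fuel-bounded; fuel n suffices for n ≥ 1, p ≥ 2)
val : ℕ → ℕ → ℕ → ℕ
val zero p n = 0
val (suc f) p zero = 0
val (suc f) zero (suc n) = 0
val (suc f) (suc zero) (suc n) = 0
val (suc f) p@(suc (suc q)) n@(suc _) =
  if does (p ∣? n) then suc (val f p (n / p)) else 0

βpow : ℕ → ℤ
βpow 0 = ℤ.1ℤ
βpow 1 = ℤ.- (+ 2)
βpow 2 = ℤ.1ℤ
βpow _ = ℤ.0ℤ

-- β: the multiplicative function with β(p)=-2, β(p²)=1, β(p^r)=0 (r≥3)
-- β(n) = ∏_{p ∣ n} βpow(v_p(n))
β : ℕ → ℤ
β n = foldr (λ p acc → βpow (val n p n) ℤ.* acc) ℤ.1ℤ (primeDivisors n)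

Σnew : (m d : ℕ) → .{{NonZero d}} → ℕ → ℤ
Σnew m d N = divSumℤ N (λ M → β (N / M) ℤ.* + Σmd m d M)

-- factor 1 + 1/(p-1) for a prime p (p ≥ 2; value at p ∈ {0,1} irrelevant)
π₂factor : ℕ → ℚ
π₂factor (suc (suc k)) = ℚ.1ℚ ℚ.+ (+ 1 ℚ./ suc k)
π₂factor _ = ℚ.1ℚ

π₂ : ℕ → ℚ
π₂ N = foldr (λ p acc → π₂factor p ℚ.* acc) ℚ.1ℚ (primeDivisors N)

{-# OPTIONS --safe #-}

-- Σ_{m,d}(N) and Σ^new_{m,d}(N) are sums over the factorisations N = τσ of kernels K(τ,σ)
-- that split multiplicatively along coprime factorisations, so both functions are
-- multiplicative and only prime powers matter. Put a_t = φ(p^t) if p^t ∣ h and a_t = 0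
-- otherwise. Then Σ_{m,d}(p^i) = Σ_{j≤i} a_{min(j,i−j)}, and since β(p^r) are the
-- coefficients of (1 − x)², Σ^new_{m,d}(p^k) is the second difference of these sums: it
-- vanishes for odd k and equals a_{j+1} − a_j for k = 2j + 2. Hence
-- |Σ^new_{m,d}(N)| ≤ gcd(N, h) ≤ h. For h = 0 the same values give
-- |Σ^new_{m,d}(N)|² N³ ≤ φ(N)⁴, which is the stated bound because π₂(N) φ(N) = N.

module Submission where

open import Defs
open import Algebra.Bundles using (CommutativeMonoid)
open import Algebra.Core using (Op₂)
open import Algebra.Structures using (IsCommutativeMonoid; IsCommutativeSemiring)
open import Data.Bool using (true; false; if_then_else_)
open import Data.Integer as ℤ using (ℤ; +_; -[1+_]; ∣_∣; 0ℤ)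
import Data.Integer.Properties as ℤ
open import Data.Integer.Tactic.RingSolver using (solve-∀)
open import Data.List using (List; []; _∷_; _++_; [_]; map; foldr; filter; length; upTo; cartesianProduct)
import Data.List.Properties as List
open import Data.List.Membership.Propositional using (_∈_; _∉_; lose)
open import Data.List.Membership.Propositional.Properties
  using (∈-∃++; ∈-map⁺; ∈-map⁻; ∈-upTo⁺; ∈-upTo⁻; ∈-filter⁺; ∈-filter⁻; ∈-++⁺ˡ; ∈-++⁺ʳ; ∈-++⁻;
         ∈-cartesianProduct⁺; ∈-cartesianProduct⁻)
open import Data.List.Membership.Propositional.Properties.WithK using (unique∧set⇒bag)
open import Data.List.Relation.Binary.BagAndSetEquality using (∼bag⇒↭)
open import Data.List.Relation.Binary.Permutation.Propositional using (_↭_; ↭-refl; ↭-prep; ↭-trans; ↭-sym; ↭⇒↭ₛ)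
import Data.List.Relation.Binary.Permutation.Propositional.Properties as ↭
import Data.List.Relation.Binary.Permutation.Setoid.Properties as ↭ₛ
open import Data.List.Relation.Binary.Subset.Propositional using (_⊆_)
import Data.List.Relation.Unary.All as All
import Data.List.Relation.Unary.All.Properties as All
open import Data.List.Relation.Unary.Any using (here; there)
open import Data.List.Relation.Unary.Unique.Propositional using (Unique; []; _∷_)
import Data.List.Relation.Unary.Unique.Propositional.Properties as Unique
open import Data.Nat
  using (ℕ; zero; suc; _+_; _*_; _^_; _∸_; _⊓_; _≤_; _<_; z≤n; s≤s; s≤s⁻¹; _≟_;
         NonZero; >-nonZero; ≢-nonZero; ≢-nonZero⁻¹; nonTrivial⇒n>1)
import Data.Nat as ℕ
open import Data.Nat.Properties
open import Data.Nat.Coprimality using (Coprime; coprime-divisor; coprime⇒gcd≡1; gcd≡1⇒coprime)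
import Data.Nat.Coprimality as Coprime
open import Data.Nat.Divisibility
open import Data.Nat.DivMod using (_/_; _%_; m*n/n≡m; m*[n/m]≡n; m≡m%n+[m/n]*n; m%n<n)
open import Data.Nat.GCD
open import Data.Nat.Induction using (<-rec)
open import Data.Nat.Primality using (Prime; prime?; prime⇒nonZero; prime⇒nonTrivial; prime⇒irreducible; euclidsLemma)
open import Data.Nat.Primality.Factorisation using (factorise)
open import Data.Nat.Solver using () renaming (module +-*-Solver to ℕ-Solver)
open import Data.Product using (_×_; _,_; ∃; ∃₂; proj₁; proj₂; uncurry)
open import Data.Rational as ℚ using (ℚ; mkℚ)
import Data.Rational.Properties as ℚ
open import Data.Rational.Solver using () renaming (module +-*-Solver to ℚ-Solver)
open import Algebra.Definitions.RawSemiring ℚ.+-*-rawSemiring using () renaming (_^_ to _^ℚ_)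
open import Algebra.Properties.CommutativeSemigroup (CommutativeMonoid.commutativeSemigroup ℚ.*-1-commutativeMonoid)
  using () renaming (interchange to ℚ*-interchange; x∙yz≈y∙xz to ℚ*-x∙yz≈y∙xz)
open import Data.Sum using (_⊎_; inj₁; inj₂)
open import Function using (_∘_; _⇔_; mk⇔)
open import Level using (0ℓ)
open import Relation.Binary.PropositionalEquality
  using (_≡_; _≢_; refl; sym; trans; cong; cong₂; subst; subst₂; setoid; module ≡-Reasoning)
open import Relation.Nullary using (¬_; yes; no; does; contradiction)
open import Relation.Nullary.Decidable using (_×-dec_; dec-true; dec-false)
open import Relation.Unary using (Pred; Decidable)
open import Relation.Unary.Properties using (∁?)

private variable
  A B : Set
  xs ys : List A
  a b c d k m n p x y u v τ : ℕ

-- Permutations and counting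

module _ {A : Set} where

  private
    remove : ∀ {x : A} {ys} → x ∈ ys → ∃ λ ys′ → ys ↭ x ∷ ys′
    remove x∈ys with h , t , refl ← ∈-∃++ x∈ys = h ++ t , ↭.shift _ h t

    ⊆-remove : ∀ {x : A} {xs ys ys′} → x ∉ xs → x ∷ xs ⊆ ys → ys ↭ x ∷ ys′ → xs ⊆ ys′
    ⊆-remove x∉xs x∷xs⊆ys ys↭ z∈xs with ↭.∈-resp-↭ ys↭ (x∷xs⊆ys (there z∈xs))
    ... | here refl = contradiction z∈xs x∉xs
    ... | there z∈ys′ = z∈ys′

  unique∧⊆∧length≤⇒↭ : {xs ys : List A} → Unique xs → xs ⊆ ys → length ys ≤ length xs → xs ↭ ys
  unique∧⊆∧length≤⇒↭ {[]} {[]} _ _ _ = ↭-refl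
  unique∧⊆∧length≤⇒↭ {x ∷ xs} {ys} ux@(_ ∷ uxs) x∷xs⊆ys ys≤
    with ys′ , ys↭ ← remove (x∷xs⊆ys (here refl)) =
    ↭-trans (↭-prep x (unique∧⊆∧length≤⇒↭ uxs xs⊆ys′ ys′≤)) (↭-sym ys↭)
    where
    xs⊆ys′ : xs ⊆ ys′
    xs⊆ys′ = ⊆-remove (Unique.Unique[x∷xs]⇒x∉xs ux) x∷xs⊆ys ys↭
    ys′≤ : length ys′ ≤ length xs
    ys′≤ = s≤s⁻¹ (subst (_≤ suc (length xs)) (↭.↭-length ys↭) ys≤)

  unique∧set⇒↭ : {xs ys : List A} → Unique xs → Unique ys → (∀ {z} → z ∈ xs ⇔ z ∈ ys) → xs ↭ ys
  unique∧set⇒↭ uxs uys xs≈ys = ∼bag⇒↭ (unique∧set⇒bag uxs uys xs≈ys)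

unique-map⁺ : {f : A → B} → (∀ {x y} → x ∈ xs → y ∈ xs → f x ≡ f y → x ≡ y) →
  Unique xs → Unique (map f xs)
unique-map⁺ _ [] = []
unique-map⁺ {f = f} inj (x∉xs ∷ uxs) =
  All.map⁺ (All.tabulate λ y∈xs fx≡fy → All.lookup x∉xs y∈xs (inj (here refl) (there y∈xs) fx≡fy))
  ∷ unique-map⁺ (λ x∈ y∈ → inj (there x∈) (there y∈)) uxs

module _ {P : Pred A 0ℓ} (P? : Decidable P) where

  length-filter-map : (f : B → A) (xs : List B) → length (filter P? (map f xs)) ≡ length (filter (P? ∘ f) xs)
  length-filter-map f [] = refl
  length-filter-map f (x ∷ xs) with P? (f x)
  ... | yes _ = cong suc (length-filter-map f xs)
  ... | no _ = length-filter-map f xs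

  length-filter+length-filter-∁ : (xs : List A) → length (filter P? xs) + length (filter (∁? P?) xs) ≡ length xs
  length-filter+length-filter-∁ [] = refl
  length-filter+length-filter-∁ (x ∷ xs) with P? x
  ... | yes _ = cong suc (length-filter+length-filter-∁ xs)
  ... | no _ = trans (+-suc _ _) (cong suc (length-filter+length-filter-∁ xs))

module _ {P : Pred A 0ℓ} {Q : Pred B 0ℓ} (P? : Decidable P) (Q? : Decidable Q) where

  length-filter-cartesianProduct : (xs : List A) (ys : List B) →
    length (filter (λ (x , y) → P? x ×-dec Q? y) (cartesianProduct xs ys))
      ≡ length (filter P? xs) * length (filter Q? ys)
  length-filter-cartesianProduct [] ys = refl
  length-filter-cartesianProduct (x ∷ xs) ys = begin
    length (filter R? (map (x ,_) ys ++ cartesianProduct xs ys))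
      ≡⟨ cong length (List.filter-++ R? (map (x ,_) ys) _) ⟩
    length (filter R? (map (x ,_) ys) ++ filter R? (cartesianProduct xs ys))
      ≡⟨ List.length-++ (filter R? (map (x ,_) ys)) ⟩
    length (filter R? (map (x ,_) ys)) + length (filter R? (cartesianProduct xs ys))
      ≡⟨ cong₂ _+_ (trans (length-filter-map R? (x ,_) ys) row) (length-filter-cartesianProduct xs ys) ⟩
    length (filter P? [ x ]) * length (filter Q? ys) + length (filter P? xs) * length (filter Q? ys)
      ≡⟨ *-distribʳ-+ (length (filter Q? ys)) (length (filter P? [ x ])) _ ⟨
    (length (filter P? [ x ]) + length (filter P? xs)) * length (filter Q? ys)
      ≡⟨ cong (λ n → n * length (filter Q? ys)) (List.length-++ (filter P? [ x ])) ⟨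
    length (filter P? [ x ] ++ filter P? xs) * length (filter Q? ys)
      ≡⟨ cong (λ zs → length zs * length (filter Q? ys)) (List.filter-++ P? [ x ] xs) ⟨
    length (filter P? (x ∷ xs)) * length (filter Q? ys) ∎
    where
    open ≡-Reasoning
    R? : Decidable (λ ((x , y) : A × B) → P x × Q y)
    R? (x , y) = P? x ×-dec Q? y
    row : length (filter (λ y → P? x ×-dec Q? y) ys) ≡ length (filter P? [ x ]) * length (filter Q? ys)
    row with P? x
    ... | yes px = trans (cong length (List.filter-≐ _ Q? (proj₂ , (px ,_)) ys)) (sym (+-identityʳ _))
    ... | no ¬px = cong length (List.filter-none _ {ys} (All.tabulate λ _ → ¬px ∘ proj₁))

length-cartesianProduct : (xs : List A) (ys : List B) →
  length (cartesianProduct xs ys) ≡ length xs * length ys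
length-cartesianProduct [] ys = refl
length-cartesianProduct (x ∷ xs) ys =
  trans (List.length-++ (map (x ,_) ys)) (cong₂ _+_ (List.length-map (x ,_) ys) (length-cartesianProduct xs ys))

-- Sums and products over lists

module BigOperator {R : Set} {_∙_ : Op₂ R} {ε : R} (isCommutativeMonoid : IsCommutativeMonoid _≡_ _∙_ ε) where

  open IsCommutativeMonoid isCommutativeMonoid using (assoc; identityˡ)

  ⨁ : List A → (A → R) → R
  ⨁ xs f = foldr (λ x acc → f x ∙ acc) ε xs

  ⨁-cong : {f g : A → R} (xs : List A) → (∀ {x} → x ∈ xs → f x ≡ g x) → ⨁ xs f ≡ ⨁ xs g
  ⨁-cong [] _ = refl
  ⨁-cong (x ∷ xs) f≗g = cong₂ _∙_ (f≗g (here refl)) (⨁-cong xs (f≗g ∘ there))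

  ⨁-map : (f : B → R) (g : A → B) (xs : List A) → ⨁ (map g xs) f ≡ ⨁ xs (f ∘ g)
  ⨁-map f g xs = List.foldr-map _ g ε xs

  ⨁-++ : (f : A → R) (xs ys : List A) → ⨁ (xs ++ ys) f ≡ ⨁ xs f ∙ ⨁ ys f
  ⨁-++ f [] ys = sym (identityˡ _)
  ⨁-++ f (x ∷ xs) ys = trans (cong (f x ∙_) (⨁-++ f xs ys)) (sym (assoc (f x) _ _))

  ⨁-↭ : (f : A → R) → xs ↭ ys → ⨁ xs f ≡ ⨁ ys f
  ⨁-↭ {xs = xs} {ys} f xs↭ys = begin
    ⨁ xs f                  ≡⟨ List.foldr-map _∙_ f ε xs ⟨
    foldr _∙_ ε (map f xs)  ≡⟨ foldr-commMonoid isCommutativeMonoid (↭⇒↭ₛ (↭.map⁺ f xs↭ys)) ⟩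
    foldr _∙_ ε (map f ys)  ≡⟨ List.foldr-map _∙_ f ε ys ⟩
    ⨁ ys f                  ∎
    where
    open ≡-Reasoning
    open ↭ₛ (setoid R) using (foldr-commMonoid)

module Summation {R : Set} {_+_ _*_ : Op₂ R} {0# 1# : R}
  (isCommutativeSemiring : IsCommutativeSemiring _≡_ _+_ _*_ 0# 1#) where

  open IsCommutativeSemiring isCommutativeSemiring
    using (+-isCommutativeMonoid; zeroˡ; zeroʳ; distribˡ; distribʳ) renaming (+-identityʳ to x+0#≡x)
  open BigOperator +-isCommutativeMonoid public
    renaming (⨁ to ∑; ⨁-cong to ∑-cong; ⨁-map to ∑-map; ⨁-++ to ∑-++; ⨁-↭ to ∑-↭)

  ∑-cartesianProduct : (f : A × B → R) (xs : List A) (ys : List B) →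
    ∑ (cartesianProduct xs ys) f ≡ ∑ xs (λ x → ∑ ys (λ y → f (x , y)))
  ∑-cartesianProduct f [] ys = refl
  ∑-cartesianProduct f (x ∷ xs) ys =
    trans (∑-++ f (map (x ,_) ys) _) (cong₂ _+_ (∑-map f (x ,_) ys) (∑-cartesianProduct f xs ys))

  ∑-distribˡ : (c : R) (f : A → R) (xs : List A) → c * ∑ xs f ≡ ∑ xs (λ x → c * f x)
  ∑-distribˡ c f [] = zeroʳ c
  ∑-distribˡ c f (x ∷ xs) = trans (distribˡ c (f x) _) (cong (_+_ (c * f x)) (∑-distribˡ c f xs))

  ∑-*-∑ : (f : A → R) (g : B → R) (xs : List A) (ys : List B) →
    ∑ xs f * ∑ ys g ≡ ∑ xs (λ x → ∑ ys (λ y → f x * g y))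
  ∑-*-∑ f g [] ys = zeroˡ _
  ∑-*-∑ f g (x ∷ xs) ys =
    trans (distribʳ (∑ ys g) (f x) _) (cong₂ _+_ (∑-distribˡ (f x) g ys) (∑-*-∑ f g xs ys))

  ∑-upTo-suc : ∀ n (f : ℕ → R) → ∑ (upTo (suc n)) f ≡ f 0 + ∑ (upTo n) (f ∘ suc)
  ∑-upTo-suc n f =
    cong (_+_ (f 0)) (trans (cong (λ xs → ∑ xs f) (sym (List.map-upTo suc n))) (∑-map f suc (upTo n)))

  ∑-upTo-∷ʳ : ∀ n (f : ℕ → R) → ∑ (upTo (suc n)) f ≡ ∑ (upTo n) f + f n
  ∑-upTo-∷ʳ n f = begin
    ∑ (upTo (suc n)) f         ≡⟨ cong (λ xs → ∑ xs f) (List.upTo-∷ʳ n) ⟨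
    ∑ (upTo n ++ [ n ]) f      ≡⟨ ∑-++ f (upTo n) [ n ] ⟩
    ∑ (upTo n) f + (f n + 0#)  ≡⟨ cong (_+_ (∑ (upTo n) f)) (x+0#≡x (f n)) ⟩
    ∑ (upTo n) f + f n         ∎
    where open ≡-Reasoning

  ∑-upTo-cong : ∀ n {f g : ℕ → R} → (∀ {i} → i < n → f i ≡ g i) → ∑ (upTo n) f ≡ ∑ (upTo n) g
  ∑-upTo-cong n f≗g = ∑-cong (upTo n) (f≗g ∘ ∈-upTo⁻)

  ∑-upTo-0# : ∀ n {f : ℕ → R} → (∀ {i} → i < n → f i ≡ 0#) → ∑ (upTo n) f ≡ 0#
  ∑-upTo-0# zero _ = refl
  ∑-upTo-0# (suc n) {f} f≡0# = begin
    ∑ (upTo (suc n)) f   ≡⟨ ∑-upTo-∷ʳ n f ⟩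
    ∑ (upTo n) f + f n   ≡⟨ cong₂ _+_ (∑-upTo-0# n (f≡0# ∘ m<n⇒m<1+n)) (f≡0# ≤-refl) ⟩
    0# + 0#              ≡⟨ x+0#≡x 0# ⟩
    0#                   ∎
    where open ≡-Reasoning

-- Coprimality and prime powers

coprime-divisors : Coprime a b → x ∣ a → y ∣ b → Coprime x y
coprime-divisors a⊥b x∣a y∣b (c∣x , c∣y) = a⊥b (∣-trans c∣x x∣a , ∣-trans c∣y y∣b)

coprime⇒*∣ : Coprime m n → m ∣ k → n ∣ k → m * n ∣ k
coprime⇒*∣ {m} {n} m⊥n (divides q refl) n∣q*m = subst (m * n ∣_) (*-comm m q)
  (*-monoʳ-∣ m (coprime-divisor (Coprime.sym m⊥n) (subst (n ∣_) (*-comm q m) n∣q*m)))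

∣*⇒≡gcd*gcd : Coprime a b → τ ∣ a * b → τ ≡ gcd τ a * gcd τ b
∣*⇒≡gcd*gcd {a} {b} {τ} a⊥b τ∣ab = ∣-antisym τ∣gcd*gcd
  (coprime⇒*∣ (coprime-divisors a⊥b (gcd[m,n]∣n τ a) (gcd[m,n]∣n τ b)) (gcd[m,n]∣m τ a) (gcd[m,n]∣m τ b))
  where
  τ∣a*gcd[τ,b] : τ ∣ a * gcd τ b
  τ∣a*gcd[τ,b] = subst (τ ∣_) (sym (c*gcd[m,n]≡gcd[cm,cn] a τ b)) (gcd-greatest (n∣m*n a) τ∣ab)
  τ∣gcd*gcd : τ ∣ gcd τ a * gcd τ b
  τ∣gcd*gcd = subst (τ ∣_) (trans (sym (c*gcd[m,n]≡gcd[cm,cn] (gcd τ b) τ a)) (*-comm (gcd τ b) (gcd τ a)))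
    (gcd-greatest (n∣m*n (gcd τ b)) (subst (τ ∣_) (*-comm a (gcd τ b)) τ∣a*gcd[τ,b]))

coprime-*ʳ : Coprime x a → Coprime x b → Coprime x (a * b)
coprime-*ʳ x⊥a x⊥b (c∣x , c∣ab) = x⊥b (c∣x , coprime-divisor (coprime-divisors x⊥a c∣x ∣-refl) c∣ab)

coprime-^ʳ : ∀ k → Coprime x a → Coprime x (a ^ k)
coprime-^ʳ {x} zero _ = Coprime.sym (Coprime.1-coprimeTo x)
coprime-^ʳ (suc k) x⊥a = coprime-*ʳ x⊥a (coprime-^ʳ k x⊥a)

gcd[xy,a]≡x : Coprime a b → x ∣ a → y ∣ b → gcd (x * y) a ≡ x
gcd[xy,a]≡x {a} {b} {x} {y} a⊥b x∣a y∣b = ∣-antisym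
  (coprime-divisor (coprime-divisors a⊥b (gcd[m,n]∣n (x * y) a) y∣b)
    (subst (gcd (x * y) a ∣_) (*-comm x y) (gcd[m,n]∣m (x * y) a)))
  (gcd-greatest (m∣m*n y) x∣a)

-- g = gcd (x * y) (u * v) splits as g₁ * g₂ with g₁ ∣ x * u and g₂ ∣ y * v, and
-- coprimality forces g₁ to divide x and u, and g₂ to divide y and v.
gcd[xy,uv]≡gcd[x,u]*gcd[y,v] : Coprime (x * u) (y * v) → gcd (x * y) (u * v) ≡ gcd x u * gcd y v
gcd[xy,uv]≡gcd[x,u]*gcd[y,v] {x} {u} {y} {v} xu⊥yv = ∣-antisym
  (subst (_∣ gcd x u * gcd y v) (sym g≡g₁*g₂)
    (*-pres-∣ (gcd-greatest g₁∣x g₁∣u) (gcd-greatest g₂∣y g₂∣v)))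
  (gcd-greatest (*-pres-∣ (gcd[m,n]∣m x u) (gcd[m,n]∣m y v)) (*-pres-∣ (gcd[m,n]∣n x u) (gcd[m,n]∣n y v)))
  where
  g g₁ g₂ : ℕ
  g = gcd (x * y) (u * v)
  g₁ = gcd g (x * u)
  g₂ = gcd g (y * v)
  g∣xy : g ∣ x * y
  g∣xy = gcd[m,n]∣m (x * y) (u * v)
  g∣uv : g ∣ u * v
  g∣uv = gcd[m,n]∣n (x * y) (u * v)
  g≡g₁*g₂ : g ≡ g₁ * g₂
  g≡g₁*g₂ = ∣*⇒≡gcd*gcd xu⊥yv (∣-trans g∣xy (*-pres-∣ (m∣m*n {x} u) (m∣m*n {y} v)))
  g₁⊥ : c ∣ y * v → Coprime g₁ c
  g₁⊥ = coprime-divisors xu⊥yv (gcd[m,n]∣n g (x * u))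
  g₂⊥ : c ∣ x * u → Coprime g₂ c
  g₂⊥ c∣xu = Coprime.sym (coprime-divisors xu⊥yv c∣xu (gcd[m,n]∣n g (y * v)))
  g₁∣x : g₁ ∣ x
  g₁∣x = coprime-divisor (g₁⊥ (m∣m*n {y} v)) (subst (g₁ ∣_) (*-comm x y) (∣-trans (gcd[m,n]∣m g _) g∣xy))
  g₁∣u : g₁ ∣ u
  g₁∣u = coprime-divisor (g₁⊥ (n∣m*n y)) (subst (g₁ ∣_) (*-comm u v) (∣-trans (gcd[m,n]∣m g _) g∣uv))
  g₂∣y : g₂ ∣ y
  g₂∣y = coprime-divisor (g₂⊥ (m∣m*n {x} u)) (∣-trans (gcd[m,n]∣m g _) g∣xy)
  g₂∣v : g₂ ∣ v
  g₂∣v = coprime-divisor (g₂⊥ (n∣m*n x)) (∣-trans (gcd[m,n]∣m g _) g∣uv)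

gcd≢0ˡ : ∀ m n .{{_ : NonZero m}} → NonZero (gcd m n)
gcd≢0ˡ m n = ≢-nonZero (gcd[m,n]≢0 m n (inj₁ (≢-nonZero⁻¹ m)))

gcd[a,n]*gcd[b,n]∣gcd[a*b,n] : Coprime a b → gcd a n * gcd b n ∣ gcd (a * b) n
gcd[a,n]*gcd[b,n]∣gcd[a*b,n] {a} {b} {n} a⊥b = coprime⇒*∣ (coprime-divisors a⊥b (gcd[m,n]∣m a n) (gcd[m,n]∣m b n))
  (gcd-greatest (∣-trans (gcd[m,n]∣m a n) (m∣m*n b)) (gcd[m,n]∣n a n))
  (gcd-greatest (∣-trans (gcd[m,n]∣m b n) (n∣m*n a)) (gcd[m,n]∣n b n))

m∣n⇒gcd[m,n]≡m : m ∣ n → gcd m n ≡ m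
m∣n⇒gcd[m,n]≡m {m} {n} m∣n = ∣-antisym (gcd[m,n]∣m m n) (gcd-greatest ∣-refl m∣n)

gcd[m,n]≥1 : 1 ≤ m → 1 ≤ gcd m n
gcd[m,n]≥1 {suc m} {n} _ = n≢0⇒n>0 (gcd[m,n]≢0 (suc m) n (inj₁ λ ()))

prime⇒1<p : Prime p → 1 < p
prime⇒1<p pp = nonTrivial⇒n>1 _ {{prime⇒nonTrivial pp}}

prime∤⇒coprime : Prime p → ¬ p ∣ m → Coprime m p
prime∤⇒coprime pp p∤m (c∣m , c∣p) with prime⇒irreducible pp c∣p
... | inj₁ c≡1 = c≡1
... | inj₂ refl = contradiction c∣m p∤m

∃-prime-divisor : 2 ≤ n → ∃ λ p → Prime p × p ∣ n
∃-prime-divisor {n} 2≤n with factorise n {{>-nonZero (≤-trans (s≤s z≤n) 2≤n)}}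
... | record { factors = [] ; isFactorisation = n≡1 } = contradiction n≡1 (>⇒≢ 2≤n)
... | record { factors = p ∷ _ ; isFactorisation = n≡p*ps ; factorsPrime = pp All.∷ _ } =
  p , pp , subst (p ∣_) (sym n≡p*ps) (m∣m*n _)

prime-power-decomposition : Prime p → ∀ n → .{{NonZero n}} → ∃₂ λ k m → n ≡ p ^ k * m × ¬ p ∣ m
prime-power-decomposition {p} pp = <-rec P decompose
  where
  P : ℕ → Set
  P n = .{{NonZero n}} → ∃₂ λ k m → n ≡ p ^ k * m × ¬ p ∣ m
  decompose : ∀ n → (∀ {q} → q < n → P q) → P n
  decompose n rec with p ∣? n
  ... | no p∤n = 0 , n , sym (+-identityʳ n) , p∤n
  ... | yes (divides q refl)
    with k , m , q≡p^k*m , p∤m ← rec (m<m*n q p {{m*n≢0⇒m≢0 q}} (prime⇒1<p pp)) {{m*n≢0⇒m≢0 q}} =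
    suc k , m , q*p≡ , p∤m
    where
    q*p≡ : q * p ≡ p * p ^ k * m
    q*p≡ = trans (*-comm q p) (trans (cong (p *_) q≡p^k*m) (sym (*-assoc p (p ^ k) m)))

module _ (Q : ℕ → Set) (Q[1] : Q 1) (Q[p^1+k] : ∀ {p} k → Prime p → Q (p ^ suc k))
  (Q[a*b] : ∀ {a b} → 1 ≤ a → 1 ≤ b → Coprime a b → Q a → Q b → Q (a * b)) where

  multiplicative-induction : ∀ n → 1 ≤ n → Q n
  multiplicative-induction = <-rec (λ n → 1 ≤ n → Q n) step
    where
    step : ∀ n → (∀ {m} → m < n → 1 ≤ m → Q m) → 1 ≤ n → Q n
    step 1 _ _ = Q[1]
    step n@(suc (suc _)) rec _
      with p , pp , p∣n ← ∃-prime-divisor {n} (s≤s (s≤s z≤n))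
      with prime-power-decomposition pp n
    ... | zero , m , n≡1*m , p∤m = contradiction (subst (p ∣_) (trans n≡1*m (*-identityˡ m)) p∣n) p∤m
    ... | suc k , m , n≡p^k*m , p∤m = subst Q (sym n≡p^k*m)
      (Q[a*b] 1≤p^k 1≤m p^k⊥m (Q[p^1+k] k pp) (rec m<n 1≤m))
      where
      1≤m : 1 ≤ m
      1≤m = n≢0⇒n>0 λ { refl → p∤m (p ∣0) }
      1≤p^k : 1 ≤ p ^ suc k
      1≤p^k = m^n>0 p {{prime⇒nonZero pp}} (suc k)
      p^k⊥m : Coprime (p ^ suc k) m
      p^k⊥m = Coprime.sym (coprime-^ʳ (suc k) (prime∤⇒coprime pp p∤m))
      m<n : m < n
      m<n = subst (m <_) (trans (*-comm m _) (sym n≡p^k*m))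
        (m<m*n m (p ^ suc k) {{>-nonZero 1≤m}} (^-monoʳ-< p (prime⇒1<p pp) {0} {suc k} (s≤s z≤n)))

module _ {p} (pp : Prime p) where

  private instance
    p≢0 : NonZero p
    p≢0 = prime⇒nonZero pp

  p^i∣p^j : ∀ {i j} → i ≤ j → p ^ i ∣ p ^ j
  p^i∣p^j {i} {j} i≤j = divides (p ^ (j ∸ i)) (begin
    p ^ j                ≡⟨ cong (p ^_) (m+[n∸m]≡n i≤j) ⟨
    p ^ (i + (j ∸ i))    ≡⟨ ^-distribˡ-+-* p i (j ∸ i) ⟩
    p ^ i * p ^ (j ∸ i)  ≡⟨ *-comm (p ^ i) _ ⟩
    p ^ (j ∸ i) * p ^ i  ∎)
    where open ≡-Reasoning

  ^-injectiveʳ : p ^ m ≡ p ^ n → m ≡ n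
  ^-injectiveʳ {m} {n} p^m≡p^n = ≤-antisym (≮⇒≥ (n≮m p^m≡p^n)) (≮⇒≥ (n≮m (sym p^m≡p^n)))
    where
    n≮m : ∀ {i j} → p ^ i ≡ p ^ j → ¬ j < i
    n≮m e j<i = <-irrefl (sym e) (^-monoʳ-< p (prime⇒1<p pp) j<i)

  gcd[p^i,p^j]≡p^[i⊓j] : ∀ i j → gcd (p ^ i) (p ^ j) ≡ p ^ (i ⊓ j)
  gcd[p^i,p^j]≡p^[i⊓j] i j with ≤-total i j
  ... | inj₁ i≤j = trans (m∣n⇒gcd[m,n]≡m (p^i∣p^j i≤j)) (cong (p ^_) (sym (m≤n⇒m⊓n≡m i≤j)))
  ... | inj₂ j≤i = trans (gcd-comm (p ^ i) (p ^ j))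
    (trans (m∣n⇒gcd[m,n]≡m (p^i∣p^j j≤i)) (cong (p ^_) (sym (m≥n⇒m⊓n≡n j≤i))))

  ∣p^k⇒≡p^i : ∀ k → τ ∣ p ^ k → ∃ λ i → i ≤ k × τ ≡ p ^ i
  ∣p^k⇒≡p^i zero τ∣1 = 0 , z≤n , ∣1⇒≡1 τ∣1
  ∣p^k⇒≡p^i {τ} (suc k) τ∣p^1+k with p ∣? τ
  ... | no p∤τ
    with i , i≤k , τ≡p^i ← ∣p^k⇒≡p^i k (coprime-divisor (prime∤⇒coprime pp p∤τ) τ∣p^1+k) =
    i , m≤n⇒m≤1+n i≤k , τ≡p^i
  ... | yes (divides q refl)
    with i , i≤k , q≡p^i ← ∣p^k⇒≡p^i k (*-cancelˡ-∣ p (subst (_∣ p * p ^ k) (*-comm q p) τ∣p^1+k)) =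
    suc i , s≤s i≤k , trans (*-comm q p) (cong (p *_) q≡p^i)

  prime∣p^k⇒≡ : ∀ {q} k → Prime q → q ∣ p ^ k → q ≡ p
  prime∣p^k⇒≡ zero pq q∣1 = contradiction (∣1⇒≡1 q∣1) (>⇒≢ (prime⇒1<p pq))
  prime∣p^k⇒≡ (suc k) pq q∣p^1+k with euclidsLemma p (p ^ k) pq q∣p^1+k
  ... | inj₂ q∣p^k = prime∣p^k⇒≡ k pq q∣p^k
  ... | inj₁ q∣p with prime⇒irreducible pp q∣p
  ...   | inj₁ q≡1 = contradiction q≡1 (>⇒≢ (prime⇒1<p pq))
  ...   | inj₂ q≡p = q≡p

-- Divisor sums

length-oneTo : ∀ n → length (oneTo n) ≡ n
length-oneTo n = trans (List.length-map suc (upTo n)) (List.length-upTo n)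

oneTo-unique : ∀ n → Unique (oneTo n)
oneTo-unique n = Unique.map⁺ suc-injective (Unique.upTo⁺ n)

∈-oneTo⁺ : 1 ≤ x → x ≤ n → x ∈ oneTo n
∈-oneTo⁺ {suc x} _ x≤n = ∈-map⁺ suc (∈-upTo⁺ x≤n)

∈-oneTo⁻ : x ∈ oneTo n → 1 ≤ x × x ≤ n
∈-oneTo⁻ x∈ with _ , y∈ , refl ← ∈-map⁻ suc x∈ = s≤s z≤n , ∈-upTo⁻ y∈

divisors : ℕ → List ℕ
divisors n = filter (_∣? n) (oneTo n)

divisors-unique : ∀ n → Unique (divisors n)
divisors-unique n = Unique.filter⁺ (_∣? n) (oneTo-unique n)

∈-divisors⁺ : .{{NonZero n}} → τ ∣ n → τ ∈ divisors n
∈-divisors⁺ {τ = zero} 0∣n = contradiction (0∣⇒≡0 0∣n) (≢-nonZero⁻¹ _)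
∈-divisors⁺ {τ = suc τ} τ∣n = ∈-filter⁺ (_∣? _) (∈-oneTo⁺ (s≤s z≤n) (∣⇒≤ τ∣n)) τ∣n

∈-divisors⁻ : ∀ n → τ ∈ divisors n → τ ∣ n × 1 ≤ τ
∈-divisors⁻ n τ∈ with τ∈oneTo , τ∣n ← ∈-filter⁻ (_∣? n) {xs = oneTo n} τ∈ =
  τ∣n , proj₁ (∈-oneTo⁻ τ∈oneTo)

-- n / τ, made total by the junk value 0 at τ = 0
cofactor : ℕ → ℕ → ℕ
cofactor n zero = 0
cofactor n (suc τ) = n / suc τ

cofactor-∣ : τ ∣ n → 1 ≤ τ → τ * cofactor n τ ≡ n
cofactor-∣ {suc τ} τ∣n _ = m*[n/m]≡n τ∣n

cofactor-* : a ∣ m → b ∣ n → 1 ≤ a → 1 ≤ b → cofactor (m * n) (a * b) ≡ cofactor m a * cofactor n b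
cofactor-* {suc a} {b = suc b} (divides q refl) (divides r refl) _ _ = begin
  q * suc a * (r * suc b) / (suc a * suc b)    ≡⟨ cong (_/ (suc a * suc b)) (rearrange q (suc a) r (suc b)) ⟩
  q * r * (suc a * suc b) / (suc a * suc b)    ≡⟨ m*n/n≡m (q * r) (suc a * suc b) ⟩
  q * r                                        ≡⟨ cong₂ _*_ (m*n/n≡m q (suc a)) (m*n/n≡m r (suc b)) ⟨
  q * suc a / suc a * (r * suc b / suc b)      ∎
  where
  open ≡-Reasoning
  open ℕ-Solver using (solve; _:*_; _:=_)
  rearrange : ∀ q a r b → q * a * (r * b) ≡ q * r * (a * b)
  rearrange = solve 4 (λ q a r b → q :* a :* (r :* b) := q :* r :* (a :* b)) refl

cofactor≥1 : 1 ≤ n → τ ∣ n → 1 ≤ τ → 1 ≤ cofactor n τ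
cofactor≥1 {n} {τ} 1≤n τ∣n 1≤τ = n≢0⇒n>0 λ c≡0 → <⇒≢ 1≤n (begin
  0                 ≡⟨ *-zeroʳ τ ⟨
  τ * 0             ≡⟨ cong (τ *_) c≡0 ⟨
  τ * cofactor n τ  ≡⟨ cofactor-∣ τ∣n 1≤τ ⟩
  n                 ∎)
  where open ≡-Reasoning

divisors-*↭ : 1 ≤ a → 1 ≤ b → Coprime a b →
  divisors (a * b) ↭ map (uncurry _*_) (cartesianProduct (divisors a) (divisors b))
divisors-*↭ {a} {b} 1≤a 1≤b a⊥b =
  unique∧set⇒↭ (divisors-unique (a * b)) products-unique (mk⇔ factor multiply)
  where
  instance
    a≢0 : NonZero a
    a≢0 = >-nonZero 1≤a
    b≢0 : NonZero b
    b≢0 = >-nonZero 1≤b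
    ab≢0 : NonZero (a * b)
    ab≢0 = m*n≢0 a b
  pairs : List (ℕ × ℕ)
  pairs = cartesianProduct (divisors a) (divisors b)
  components : ∀ {x y} → (x , y) ∈ pairs → (gcd (x * y) a , gcd (x * y) b) ≡ (x , y)
  components {x} {y} xy∈ with x∈ , y∈ ← ∈-cartesianProduct⁻ (divisors a) (divisors b) xy∈ =
    cong₂ _,_ (gcd[xy,a]≡x a⊥b x∣a y∣b)
              (trans (cong (λ z → gcd z b) (*-comm x y)) (gcd[xy,a]≡x (Coprime.sym a⊥b) y∣b x∣a))
    where
    x∣a : x ∣ a
    x∣a = proj₁ (∈-divisors⁻ a x∈)
    y∣b : y ∣ b
    y∣b = proj₁ (∈-divisors⁻ b y∈)
  products-unique : Unique (map (uncurry _*_) pairs)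
  products-unique = unique-map⁺
    (λ p∈ q∈ xy≡x′y′ → trans (sym (components p∈)) (trans (cong (λ z → gcd z a , gcd z b) xy≡x′y′) (components q∈)))
    (Unique.cartesianProduct⁺ (divisors-unique a) (divisors-unique b))
  factor : τ ∈ divisors (a * b) → τ ∈ map (uncurry _*_) pairs
  factor {τ} τ∈ = subst (_∈ map (uncurry _*_) pairs) (sym (∣*⇒≡gcd*gcd a⊥b (proj₁ (∈-divisors⁻ (a * b) τ∈))))
    (∈-map⁺ (uncurry _*_)
      (∈-cartesianProduct⁺ (∈-divisors⁺ (gcd[m,n]∣n τ a)) (∈-divisors⁺ (gcd[m,n]∣n τ b))))
  multiply : τ ∈ map (uncurry _*_) pairs → τ ∈ divisors (a * b)
  multiply τ∈ with (x , y) , xy∈ , refl ← ∈-map⁻ (uncurry _*_) τ∈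
    with x∈ , y∈ ← ∈-cartesianProduct⁻ (divisors a) (divisors b) xy∈ =
    ∈-divisors⁺ (*-pres-∣ (proj₁ (∈-divisors⁻ a x∈)) (proj₁ (∈-divisors⁻ b y∈)))

divisors-p^k↭ : Prime p → ∀ k → divisors (p ^ k) ↭ map (p ^_) (upTo (suc k))
divisors-p^k↭ {p} pp k = unique∧set⇒↭ (divisors-unique (p ^ k))
  (Unique.map⁺ (^-injectiveʳ pp) (Unique.upTo⁺ (suc k))) (mk⇔ to from)
  where
  instance
    p^k≢0 : NonZero (p ^ k)
    p^k≢0 = m^n≢0 p k {{prime⇒nonZero pp}}
  to : ∀ {τ} → τ ∈ divisors (p ^ k) → τ ∈ map (p ^_) (upTo (suc k))
  to τ∈ with i , i≤k , refl ← ∣p^k⇒≡p^i pp k (proj₁ (∈-divisors⁻ (p ^ k) τ∈)) =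
    ∈-map⁺ (p ^_) (∈-upTo⁺ (s≤s i≤k))
  from : ∀ {τ} → τ ∈ map (p ^_) (upTo (suc k)) → τ ∈ divisors (p ^ k)
  from τ∈ with i , i∈ , refl ← ∈-map⁻ (p ^_) τ∈ = ∈-divisors⁺ (p^i∣p^j pp (s≤s⁻¹ (∈-upTo⁻ i∈)))

cofactor-p^k : Prime p → ∀ {i k} → i ≤ k → cofactor (p ^ k) (p ^ i) ≡ p ^ (k ∸ i)
cofactor-p^k {p} pp {i} {k} i≤k = *-cancelˡ-≡ _ _ (p ^ i) {{m^n≢0 p i {{prime⇒nonZero pp}}}} (begin
  p ^ i * cofactor (p ^ k) (p ^ i)  ≡⟨ cofactor-∣ (p^i∣p^j pp i≤k) (m^n>0 p {{prime⇒nonZero pp}} i) ⟩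
  p ^ k                             ≡⟨ cong (p ^_) (m+[n∸m]≡n i≤k) ⟨
  p ^ (i + (k ∸ i))                 ≡⟨ ^-distribˡ-+-* p i (k ∸ i) ⟩
  p ^ i * p ^ (k ∸ i)               ∎)
  where open ≡-Reasoning

Multiplicative : {R : Set} → Op₂ R → (ℕ → R) → Set
Multiplicative _·_ f = ∀ a b → 1 ≤ a → 1 ≤ b → Coprime a b → f (a * b) ≡ f a · f b

multiplicative-resp-≗ : ∀ {R : Set} {_·_ : Op₂ R} {f g : ℕ → R} →
  (∀ n → f n ≡ g n) → Multiplicative _·_ g → Multiplicative _·_ f
multiplicative-resp-≗ {_·_ = _·_} f≗g g-mult a b 1≤a 1≤b a⊥b =
  trans (f≗g (a * b)) (trans (g-mult a b 1≤a 1≤b a⊥b) (sym (cong₂ _·_ (f≗g a) (f≗g b))))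

Multiplicative₂ : {R : Set} → Op₂ R → (ℕ → ℕ → R) → Set
Multiplicative₂ _·_ K = ∀ {x u y v} → 1 ≤ x → 1 ≤ u → 1 ≤ y → 1 ≤ v →
  Coprime (x * u) (y * v) → K (x * y) (u * v) ≡ K x u · K y v

module DivisorSum {R : Set} {_+_ _*_ : Op₂ R} {0# 1# : R}
  (isCommutativeSemiring : IsCommutativeSemiring _≡_ _+_ _*_ 0# 1#) where

  open Summation isCommutativeSemiring public
  open IsCommutativeSemiring isCommutativeSemiring using () renaming (+-identityˡ to 0#+x≡x)

  -- divSumℕ and divSumℤ of Defs unfold to the left-hand side
  foldr-upTo≡∑-divisors : (f : ℕ → R) (n : ℕ) →
    foldr (λ k acc → (if does (suc k ∣? n) then f (suc k) else 0#) + acc) 0# (upTo n) ≡ ∑ (divisors n) f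
  foldr-upTo≡∑-divisors f n = go (upTo n)
    where
    go : ∀ ks → foldr (λ k acc → (if does (suc k ∣? n) then f (suc k) else 0#) + acc) 0# ks
              ≡ ∑ (filter (_∣? n) (map suc ks)) f
    go [] = refl
    go (k ∷ ks) with does (suc k ∣? n)
    ... | true = cong (_+_ (f (suc k))) (go ks)
    ... | false = trans (0#+x≡x _) (go ks)

  ∑-divisors-multiplicative : (K : ℕ → ℕ → R) → Multiplicative₂ _*_ K →
    Multiplicative _*_ (λ n → ∑ (divisors n) (λ τ → K τ (cofactor n τ)))
  ∑-divisors-multiplicative K K-mult a b 1≤a 1≤b a⊥b = begin
    ∑ (divisors (a ℕ.* b)) (F (a ℕ.* b))
      ≡⟨ ∑-↭ (F (a ℕ.* b)) (divisors-*↭ 1≤a 1≤b a⊥b) ⟩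
    ∑ (map (uncurry ℕ._*_) (cartesianProduct (divisors a) (divisors b))) (F (a ℕ.* b))
      ≡⟨ ∑-map (F (a ℕ.* b)) (uncurry ℕ._*_) (cartesianProduct (divisors a) (divisors b)) ⟩
    ∑ (cartesianProduct (divisors a) (divisors b)) (F (a ℕ.* b) ∘ uncurry ℕ._*_)
      ≡⟨ ∑-cartesianProduct _ (divisors a) (divisors b) ⟩
    ∑ (divisors a) (λ x → ∑ (divisors b) (λ y → F (a ℕ.* b) (x ℕ.* y)))
      ≡⟨ ∑-cong (divisors a) (λ x∈ → ∑-cong (divisors b) (λ y∈ → split x∈ y∈)) ⟩
    ∑ (divisors a) (λ x → ∑ (divisors b) (λ y → F a x * F b y))
      ≡⟨ ∑-*-∑ (F a) (F b) (divisors a) (divisors b) ⟨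
    ∑ (divisors a) (F a) * ∑ (divisors b) (F b) ∎
    where
    open ≡-Reasoning
    F : ℕ → ℕ → R
    F n τ = K τ (cofactor n τ)
    split : ∀ {x y} → x ∈ divisors a → y ∈ divisors b → F (a ℕ.* b) (x ℕ.* y) ≡ F a x * F b y
    split {x} {y} x∈ y∈ with x∣a , 1≤x ← ∈-divisors⁻ a x∈ | y∣b , 1≤y ← ∈-divisors⁻ b y∈ =
      trans (cong (K (x ℕ.* y)) (cofactor-* x∣a y∣b 1≤x 1≤y))
        (K-mult 1≤x (cofactor≥1 1≤a x∣a 1≤x) 1≤y (cofactor≥1 1≤b y∣b 1≤y)
          (subst₂ Coprime (sym (cofactor-∣ x∣a 1≤x)) (sym (cofactor-∣ y∣b 1≤y)) a⊥b))

  ∑-divisors-p^k : Prime p → ∀ k (f : ℕ → R) → ∑ (divisors (p ^ k)) f ≡ ∑ (upTo (suc k)) (f ∘ (p ^_))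
  ∑-divisors-p^k {p} pp k f = trans (∑-↭ f (divisors-p^k↭ pp k)) (∑-map f (p ^_) (upTo (suc k)))

module ℕ-∑ = DivisorSum +-*-isCommutativeSemiring
module ℤ-∑ = DivisorSum ℤ.+-*-isCommutativeSemiring
open ℤ-∑ using (∑; ∑-upTo-suc; ∑-upTo-∷ʳ; ∑-upTo-cong; ∑-upTo-0#; ∑-divisors-p^k)

+-∑ : ∀ {A : Set} (xs : List A) (f : A → ℕ) → + ℕ-∑.∑ xs f ≡ ∑ xs (+_ ∘ f)
+-∑ [] f = refl
+-∑ (x ∷ xs) f = trans (ℤ.pos-+ (f x) _) (cong (ℤ._+_ (+ f x)) (+-∑ xs f))

-- Euler's totient function

∣∧<⇒≡0 : n ∣ m → m < n → m ≡ 0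
∣∧<⇒≡0 {m = zero} _ _ = refl
∣∧<⇒≡0 {m = suc m} n∣m m<n = contradiction n∣m (>⇒∤ m<n)

oneTo-∣∸-injective : x ∈ oneTo n → y ∈ oneTo n → n ∣ y ∸ x → n ∣ x ∸ y → x ≡ y
oneTo-∣∸-injective x∈ y∈ n∣y∸x n∣x∸y =
  ≤-antisym (m∸n≡0⇒m≤n (∣∧<⇒≡0 n∣x∸y (∸< x∈ y∈))) (m∸n≡0⇒m≤n (∣∧<⇒≡0 n∣y∸x (∸< y∈ x∈)))
  where
  ∸< : x ∈ oneTo n → y ∈ oneTo n → x ∸ y < n
  ∸< {suc x} {y = suc y} x∈ _ = ≤-<-trans (m∸n≤m x y) (proj₂ (∈-oneTo⁻ x∈))
  ∸< {zero} x∈ _ = contradiction (proj₁ (∈-oneTo⁻ x∈)) λ ()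
  ∸< {suc x} {y = zero} _ y∈ = contradiction (proj₁ (∈-oneTo⁻ y∈)) λ ()

%≡%⇒∣∸ : .{{_ : NonZero n}} → x % n ≡ y % n → n ∣ y ∸ x
%≡%⇒∣∸ {n} {x} {y} x%n≡y%n = divides (y / n ∸ x / n) (begin
  y ∸ x                                      ≡⟨ cong₂ _∸_ (m≡m%n+[m/n]*n y n) (m≡m%n+[m/n]*n x n) ⟩
  (y % n + y / n * n) ∸ (x % n + x / n * n)  ≡⟨ cong (λ r → (y % n + y / n * n) ∸ (r + x / n * n)) x%n≡y%n ⟩
  (y % n + y / n * n) ∸ (y % n + x / n * n)  ≡⟨ [m+n]∸[m+o]≡n∸o (y % n) _ _ ⟩
  y / n * n ∸ x / n * n                      ≡⟨ *-distribʳ-∸ n (y / n) (x / n) ⟨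
  (y / n ∸ x / n) * n                        ∎)
  where open ≡-Reasoning

gcd[m%n,n]≡gcd[m,n] : ∀ m n .{{_ : NonZero n}} → gcd (m % n) n ≡ gcd m n
gcd[m%n,n]≡gcd[m,n] m n = ∣-antisym
  (gcd-greatest (∣n∣m%n⇒∣m (gcd[m,n]∣n (m % n) n) (gcd[m,n]∣m (m % n) n)) (gcd[m,n]∣n (m % n) n))
  (gcd-greatest (%-presˡ-∣ (gcd[m,n]∣m m n) (gcd[m,n]∣n m n)) (gcd[m,n]∣n m n))

private
  coprimeTo? : ∀ n → Decidable (λ x → gcd x n ≡ 1)
  coprimeTo? n x = gcd x n ≟ 1

map-%-oneTo↭upTo : ∀ n .{{_ : NonZero n}} → map (_% n) (oneTo n) ↭ upTo n
map-%-oneTo↭upTo n = unique∧⊆∧length≤⇒↭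
  (unique-map⁺ (λ x∈ y∈ e → oneTo-∣∸-injective x∈ y∈ (%≡%⇒∣∸ e) (%≡%⇒∣∸ (sym e))) (oneTo-unique n))
  residue<n
  (≤-reflexive (trans (List.length-upTo n) (sym (trans (List.length-map (_% n) (oneTo n)) (length-oneTo n)))))
  where
  residue<n : ∀ {r} → r ∈ map (_% n) (oneTo n) → r ∈ upTo n
  residue<n r∈ with x , _ , refl ← ∈-map⁻ (_% n) r∈ = ∈-upTo⁺ (m%n<n x n)

-- φ counts in 1, …, n, whereas residues modulo n live in 0, …, n − 1.
φ≡length-filter-upTo : ∀ n .{{_ : NonZero n}} → φ n ≡ length (filter (coprimeTo? n) (upTo n))
φ≡length-filter-upTo n = begin
  length (filter (coprimeTo? n) (oneTo n))
    ≡⟨ cong length (List.filter-≐ {Q = λ x → gcd (x % n) n ≡ 1} (coprimeTo? n) (coprimeTo? n ∘ (_% n))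
         ((λ {x} → trans (gcd[m%n,n]≡gcd[m,n] x n)) , (λ {x} → trans (sym (gcd[m%n,n]≡gcd[m,n] x n)))) (oneTo n)) ⟩
  length (filter (coprimeTo? n ∘ (_% n)) (oneTo n))
    ≡⟨ length-filter-map (coprimeTo? n) (_% n) (oneTo n) ⟨
  length (filter (coprimeTo? n) (map (_% n) (oneTo n)))
    ≡⟨ ↭.↭-length (↭.filter-↭ (coprimeTo? n) (map-%-oneTo↭upTo n)) ⟩
  length (filter (coprimeTo? n) (upTo n)) ∎
  where open ≡-Reasoning

module _ {a b} .{{_ : NonZero a}} .{{_ : NonZero b}} (a⊥b : Coprime a b) where

  private instance
    ab≢0 : NonZero (a * b)
    ab≢0 = m*n≢0 a b

  residues : ℕ → ℕ × ℕ
  residues x = x % a , x % b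

  chinese-remainder : map residues (oneTo (a * b)) ↭ cartesianProduct (upTo a) (upTo b)
  chinese-remainder =
    unique∧⊆∧length≤⇒↭ (unique-map⁺ injective (oneTo-unique (a * b))) residues∈ (≤-reflexive (begin
    length (cartesianProduct (upTo a) (upTo b))  ≡⟨ length-cartesianProduct (upTo a) (upTo b) ⟩
    length (upTo a) * length (upTo b)            ≡⟨ cong₂ _*_ (List.length-upTo a) (List.length-upTo b) ⟩
    a * b                                        ≡⟨ length-oneTo (a * b) ⟨
    length (oneTo (a * b))                       ≡⟨ List.length-map residues (oneTo (a * b)) ⟨
    length (map residues (oneTo (a * b)))        ∎))
    where
    open ≡-Reasoning
    ab∣ : residues x ≡ residues y → a * b ∣ y ∸ x
    ab∣ e = coprime⇒*∣ a⊥b (%≡%⇒∣∸ (cong proj₁ e)) (%≡%⇒∣∸ (cong proj₂ e))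
    injective : x ∈ oneTo (a * b) → y ∈ oneTo (a * b) → residues x ≡ residues y → x ≡ y
    injective x∈ y∈ e = oneTo-∣∸-injective x∈ y∈ (ab∣ e) (ab∣ (sym e))
    residues∈ : ∀ {r} → r ∈ map residues (oneTo (a * b)) → r ∈ cartesianProduct (upTo a) (upTo b)
    residues∈ r∈ with x , _ , refl ← ∈-map⁻ residues r∈ =
      ∈-cartesianProduct⁺ (∈-upTo⁺ (m%n<n x a)) (∈-upTo⁺ (m%n<n x b))

φ-multiplicative : Multiplicative _*_ φ
φ-multiplicative a b 1≤a 1≤b a⊥b = begin
  length (filter (coprimeTo? (a * b)) (oneTo (a * b)))
    ≡⟨ cong length (List.filter-≐ {Q = Q} (coprimeTo? (a * b)) (R? ∘ residues a⊥b) (to , from) (oneTo (a * b))) ⟩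
  length (filter (R? ∘ residues a⊥b) (oneTo (a * b)))
    ≡⟨ length-filter-map R? (residues a⊥b) (oneTo (a * b)) ⟨
  length (filter R? (map (residues a⊥b) (oneTo (a * b))))
    ≡⟨ ↭.↭-length (↭.filter-↭ R? (chinese-remainder a⊥b)) ⟩
  length (filter R? (cartesianProduct (upTo a) (upTo b)))
    ≡⟨ length-filter-cartesianProduct (coprimeTo? a) (coprimeTo? b) (upTo a) (upTo b) ⟩
  length (filter (coprimeTo? a) (upTo a)) * length (filter (coprimeTo? b) (upTo b))
    ≡⟨ cong₂ _*_ (φ≡length-filter-upTo a) (φ≡length-filter-upTo b) ⟨
  φ a * φ b ∎
  where
  open ≡-Reasoning
  instance
    a≢0 : NonZero a
    a≢0 = >-nonZero 1≤a
    b≢0 : NonZero b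
    b≢0 = >-nonZero 1≤b
  R? : Decidable (λ ((r , s) : ℕ × ℕ) → gcd r a ≡ 1 × gcd s b ≡ 1)
  R? (r , s) = coprimeTo? a r ×-dec coprimeTo? b s
  Q : ℕ → Set
  Q x = gcd (x % a) a ≡ 1 × gcd (x % b) b ≡ 1
  to : ∀ {x} → gcd x (a * b) ≡ 1 → Q x
  to {x} e = trans (gcd[m%n,n]≡gcd[m,n] x a) (coprime⇒gcd≡1 (coprime-divisors x⊥ab ∣-refl (m∣m*n {a} b)))
           , trans (gcd[m%n,n]≡gcd[m,n] x b) (coprime⇒gcd≡1 (coprime-divisors x⊥ab ∣-refl (n∣m*n a)))
    where
    x⊥ab : Coprime x (a * b)
    x⊥ab = gcd≡1⇒coprime e
  from : ∀ {x} → Q x → gcd x (a * b) ≡ 1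
  from {x} (ea , eb) = coprime⇒gcd≡1 {x} {a * b}
    (coprime-*ʳ (gcd≡1⇒coprime (trans (sym (gcd[m%n,n]≡gcd[m,n] x a)) ea))
                (gcd≡1⇒coprime (trans (sym (gcd[m%n,n]≡gcd[m,n] x b)) eb)))

module _ {p} (pp : Prime p) where

  private instance
    p≢0 : NonZero p
    p≢0 = prime⇒nonZero pp

  multiples↭ : ∀ m → filter (p ∣?_) (upTo (p * m)) ↭ map (p *_) (upTo m)
  multiples↭ m = unique∧set⇒↭ (Unique.filter⁺ (p ∣?_) (Unique.upTo⁺ (p * m)))
    (Unique.map⁺ (*-cancelˡ-≡ _ _ p) (Unique.upTo⁺ m)) (mk⇔ to from)
    where
    to : x ∈ filter (p ∣?_) (upTo (p * m)) → x ∈ map (p *_) (upTo m)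
    to x∈ with x∈upTo , divides q refl ← ∈-filter⁻ (p ∣?_) {xs = upTo (p * m)} x∈ =
      subst (_∈ map (p *_) (upTo m)) (*-comm p q)
        (∈-map⁺ (p *_) (∈-upTo⁺ (*-cancelˡ-< p q m (subst (_< p * m) (*-comm q p) (∈-upTo⁻ x∈upTo)))))
    from : x ∈ map (p *_) (upTo m) → x ∈ filter (p ∣?_) (upTo (p * m))
    from x∈ with q , q∈ , refl ← ∈-map⁻ (p *_) x∈ =
      ∈-filter⁺ (p ∣?_) (∈-upTo⁺ (*-monoʳ-< p (∈-upTo⁻ q∈))) (m∣m*n q)

  φ[p^1+k]+p^k≡p^1+k : ∀ k → φ (p ^ suc k) + p ^ k ≡ p ^ suc k
  φ[p^1+k]+p^k≡p^1+k k = begin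
    φ N + p ^ k
      ≡⟨ cong₂ _+_ (φ≡length-filter-upTo N {{m^n≢0 p (suc k)}}) (sym #multiples) ⟩
    length (filter (coprimeTo? N) (upTo N)) + length (filter (p ∣?_) (upTo N))
      ≡⟨ cong (λ xs → length xs + length (filter (p ∣?_) (upTo N)))
              (List.filter-≐ {Q = λ x → ¬ p ∣ x} (coprimeTo? N) (∁? (p ∣?_)) (coprime⇒∤ , ∤⇒coprime) (upTo N))
       ⟩
    length (filter (∁? (p ∣?_)) (upTo N)) + length (filter (p ∣?_) (upTo N))
      ≡⟨ +-comm (length (filter (∁? (p ∣?_)) (upTo N))) _ ⟩
    length (filter (p ∣?_) (upTo N)) + length (filter (∁? (p ∣?_)) (upTo N))
      ≡⟨ length-filter+length-filter-∁ (p ∣?_) (upTo N) ⟩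
    length (upTo N)
      ≡⟨ List.length-upTo N ⟩
    N ∎
    where
    open ≡-Reasoning
    N : ℕ
    N = p ^ suc k
    #multiples : length (filter (p ∣?_) (upTo N)) ≡ p ^ k
    #multiples = trans (↭.↭-length (multiples↭ (p ^ k)))
      (trans (List.length-map (p *_) (upTo (p ^ k))) (List.length-upTo (p ^ k)))
    coprime⇒∤ : gcd x N ≡ 1 → ¬ p ∣ x
    coprime⇒∤ {x} e p∣x =
      contradiction (∣1⇒≡1 (subst (p ∣_) e (gcd-greatest p∣x (m∣m*n (p ^ k))))) (>⇒≢ (prime⇒1<p pp))
    ∤⇒coprime : ¬ p ∣ x → gcd x N ≡ 1
    ∤⇒coprime {x} p∤x = coprime⇒gcd≡1 {x} {N} (coprime-^ʳ (suc k) (prime∤⇒coprime pp p∤x))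

  φ[p^1+k]≡p^k*[p∸1] : ∀ k → φ (p ^ suc k) ≡ p ^ k * (p ∸ 1)
  φ[p^1+k]≡p^k*[p∸1] k = begin
    φ (p ^ suc k)                ≡⟨ m+n∸n≡m (φ (p ^ suc k)) (p ^ k) ⟨
    φ (p ^ suc k) + p ^ k ∸ p ^ k ≡⟨ cong (_∸ p ^ k) (φ[p^1+k]+p^k≡p^1+k k) ⟩
    p * p ^ k ∸ p ^ k            ≡⟨ cong (p * p ^ k ∸_) (*-identityˡ (p ^ k)) ⟨
    p * p ^ k ∸ 1 * p ^ k        ≡⟨ *-distribʳ-∸ (p ^ k) p 1 ⟨
    (p ∸ 1) * p ^ k              ≡⟨ *-comm (p ∸ 1) (p ^ k) ⟩
    p ^ k * (p ∸ 1)              ∎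
    where open ≡-Reasoning

φ[n]≤n : ∀ n → φ n ≤ n
φ[n]≤n n = ≤-trans (List.length-filter (coprimeTo? n) (oneTo n)) (≤-reflexive (length-oneTo n))

φ[n]≥1 : 1 ≤ n → 1 ≤ φ n
φ[n]≥1 {n} 1≤n = List.filter-some (coprimeTo? n) (lose (∈-oneTo⁺ ≤-refl 1≤n) (gcd-zeroˡ n))

-- The functions β and π₂

primeDivisors-unique : ∀ n → Unique (primeDivisors n)
primeDivisors-unique n = Unique.filter⁺ _ (oneTo-unique n)

∈-primeDivisors⁺ : 1 ≤ n → Prime p → p ∣ n → p ∈ primeDivisors n
∈-primeDivisors⁺ {n} 1≤n pp p∣n = ∈-filter⁺ (λ p → prime? p ×-dec p ∣? n)
  (∈-oneTo⁺ (<⇒≤ (prime⇒1<p pp)) (∣⇒≤ {{>-nonZero 1≤n}} p∣n)) (pp , p∣n)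

∈-primeDivisors⁻ : ∀ n → p ∈ primeDivisors n → Prime p × p ∣ n
∈-primeDivisors⁻ n p∈ = proj₂ (∈-filter⁻ (λ p → prime? p ×-dec p ∣? n) {xs = oneTo n} p∈)

primeDivisors-*↭ : 1 ≤ a → 1 ≤ b → Coprime a b → primeDivisors (a * b) ↭ primeDivisors a ++ primeDivisors b
primeDivisors-*↭ {a} {b} 1≤a 1≤b a⊥b = unique∧set⇒↭ (primeDivisors-unique (a * b))
  (Unique.++⁺ (primeDivisors-unique a) (primeDivisors-unique b) disjoint) (mk⇔ split join)
  where
  1≤ab : 1 ≤ a * b
  1≤ab = *-mono-≤ 1≤a 1≤b
  disjoint : ∀ {p} → ¬ (p ∈ primeDivisors a × p ∈ primeDivisors b)
  disjoint (p∈a , p∈b) with pp , p∣a ← ∈-primeDivisors⁻ a p∈a | _ , p∣b ← ∈-primeDivisors⁻ b p∈b =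
    contradiction (a⊥b (p∣a , p∣b)) (>⇒≢ (prime⇒1<p pp))
  split : p ∈ primeDivisors (a * b) → p ∈ primeDivisors a ++ primeDivisors b
  split p∈ with pp , p∣ab ← ∈-primeDivisors⁻ (a * b) p∈ with euclidsLemma a b pp p∣ab
  ... | inj₁ p∣a = ∈-++⁺ˡ (∈-primeDivisors⁺ 1≤a pp p∣a)
  ... | inj₂ p∣b = ∈-++⁺ʳ (primeDivisors a) (∈-primeDivisors⁺ 1≤b pp p∣b)
  join : p ∈ primeDivisors a ++ primeDivisors b → p ∈ primeDivisors (a * b)
  join p∈ with ∈-++⁻ (primeDivisors a) p∈
  ... | inj₁ p∈a = let pp , p∣a = ∈-primeDivisors⁻ a p∈a in
    ∈-primeDivisors⁺ 1≤ab pp (∣-trans p∣a (m∣m*n b))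
  ... | inj₂ p∈b = let pp , p∣b = ∈-primeDivisors⁻ b p∈b in
    ∈-primeDivisors⁺ 1≤ab pp (∣-trans p∣b (n∣m*n a))

primeDivisors-p^1+k↭ : Prime p → ∀ k → primeDivisors (p ^ suc k) ↭ [ p ]
primeDivisors-p^1+k↭ {p} pp k = unique∧set⇒↭ (primeDivisors-unique (p ^ suc k)) (All.[] ∷ [])
  (mk⇔ (λ q∈ → let pq , q∣p^1+k = ∈-primeDivisors⁻ (p ^ suc k) q∈ in
               here (prime∣p^k⇒≡ pp (suc k) pq q∣p^1+k))
       (λ { (here refl) → ∈-primeDivisors⁺ (m^n>0 p {{prime⇒nonZero pp}} (suc k)) pp (m∣m*n (p ^ k)) }))

module PrimeDivisorProduct {R : Set} {_∙_ : Op₂ R} {ε : R}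
  (isCommutativeMonoid : IsCommutativeMonoid _≡_ _∙_ ε) where

  open BigOperator isCommutativeMonoid public
  open IsCommutativeMonoid isCommutativeMonoid using (identityʳ)

  ⨁-primeDivisors-* : (f : ℕ → ℕ → R) → 1 ≤ a → 1 ≤ b → Coprime a b →
    (∀ {p} → p ∈ primeDivisors a → f (a * b) p ≡ f a p) →
    (∀ {p} → p ∈ primeDivisors b → f (a * b) p ≡ f b p) →
    ⨁ (primeDivisors (a * b)) (f (a * b)) ≡ ⨁ (primeDivisors a) (f a) ∙ ⨁ (primeDivisors b) (f b)
  ⨁-primeDivisors-* {a} {b} f 1≤a 1≤b a⊥b fa fb = begin
    ⨁ (primeDivisors (a * b)) (f (a * b))
      ≡⟨ ⨁-↭ (f (a * b)) (primeDivisors-*↭ 1≤a 1≤b a⊥b) ⟩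
    ⨁ (primeDivisors a ++ primeDivisors b) (f (a * b))
      ≡⟨ ⨁-++ (f (a * b)) (primeDivisors a) (primeDivisors b) ⟩
    ⨁ (primeDivisors a) (f (a * b)) ∙ ⨁ (primeDivisors b) (f (a * b))
      ≡⟨ cong₂ _∙_ (⨁-cong (primeDivisors a) fa) (⨁-cong (primeDivisors b) fb) ⟩
    ⨁ (primeDivisors a) (f a) ∙ ⨁ (primeDivisors b) (f b) ∎
    where open ≡-Reasoning

  ⨁-primeDivisors-p^1+k : Prime p → ∀ k (f : ℕ → R) → ⨁ (primeDivisors (p ^ suc k)) f ≡ f p
  ⨁-primeDivisors-p^1+k pp k f = trans (⨁-↭ f (primeDivisors-p^1+k↭ pp k)) (identityʳ (f _))

k<p^k : 1 < p → ∀ k → k < p ^ k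
k<p^k 1<p zero = s≤s z≤n
k<p^k {p} 1<p (suc k) = begin-strict
  suc k          ≤⟨ k<p^k 1<p k ⟩
  p ^ k          <⟨ m<m*n (p ^ k) p {{m^n≢0 p k {{>-nonZero (<-trans (s≤s z≤n) 1<p)}}}} 1<p ⟩
  p ^ k * p      ≡⟨ *-comm (p ^ k) p ⟩
  p ^ suc k      ∎
  where open ≤-Reasoning

∤⇒nonZero : ¬ p ∣ m → NonZero m
∤⇒nonZero {m = zero} p∤0 = contradiction (_ ∣0) p∤0
∤⇒nonZero {m = suc m} _ = _

val-fuel : ∀ fuel {p n m} k → Prime p → n ≡ p ^ k * m → ¬ p ∣ m → k ≤ fuel → val fuel p n ≡ k
val-fuel zero zero _ _ _ _ = refl
val-fuel (suc f) {p} {zero} {m} k pp 0≡p^k*m p∤m _ = contradiction (sym 0≡p^k*m) (≢-nonZero⁻¹ (p ^ k * m))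
  where instance
    p^k*m≢0 : NonZero (p ^ k * m)
    p^k*m≢0 = m*n≢0 (p ^ k) m {{m^n≢0 p k {{prime⇒nonZero pp}}}} {{∤⇒nonZero p∤m}}
val-fuel (suc f) {zero} {suc n} k pp _ _ _ = contradiction (prime⇒1<p pp) λ ()
val-fuel (suc f) {suc zero} {suc n} k pp _ _ _ = contradiction (prime⇒1<p pp) λ { (s≤s ()) }
val-fuel (suc f) {p@(suc (suc q))} {suc n} zero pp n≡m p∤m _ =
  cong (λ b → if b then suc (val f p (suc n / p)) else 0)
    (dec-false (p ∣? suc n) (λ p∣n → p∤m (subst (p ∣_) (trans n≡m (*-identityˡ _)) p∣n)))
val-fuel (suc f) {p@(suc (suc q))} {suc n} {m} (suc k) pp n≡p^1+k*m p∤m (s≤s k≤f) = begin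
  (if does (p ∣? suc n) then suc (val f p (suc n / p)) else 0)
    ≡⟨ cong (λ b → if b then suc (val f p (suc n / p)) else 0)
            (dec-true (p ∣? suc n) (divides (p ^ k * m) n≡p^k*m*p)) ⟩
  suc (val f p (suc n / p))
    ≡⟨ cong suc (val-fuel f k pp (trans (cong (_/ p) n≡p^k*m*p) (m*n/n≡m (p ^ k * m) p)) p∤m k≤f) ⟩
  suc k ∎
  where
  open ≡-Reasoning
  n≡p^k*m*p : suc n ≡ p ^ k * m * p
  n≡p^k*m*p = trans n≡p^1+k*m (trans (*-assoc p (p ^ k) m) (*-comm p (p ^ k * m)))

val-p-adic : Prime p → ∀ k → n ≡ p ^ k * m → ¬ p ∣ m → val n p n ≡ k
val-p-adic {p} {n} {m} pp k n≡p^k*m p∤m = val-fuel n k pp n≡p^k*m p∤m (begin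
  k          ≤⟨ <⇒≤ (k<p^k (prime⇒1<p pp) k) ⟩
  p ^ k      ≤⟨ m≤m*n (p ^ k) m {{∤⇒nonZero p∤m}} ⟩
  p ^ k * m  ≡⟨ n≡p^k*m ⟨
  n          ∎)
  where open ≤-Reasoning

val-*-coprime : Prime p → p ∣ a → 1 ≤ a → Coprime a b → val (a * b) p (a * b) ≡ val a p a
val-*-coprime {p} {a} {b} pp p∣a 1≤a a⊥b
  with k , m , a≡p^k*m , p∤m ← prime-power-decomposition pp a {{>-nonZero 1≤a}} =
  trans (val-p-adic pp k (trans (cong (_* b) a≡p^k*m) (*-assoc (p ^ k) m b)) p∤m*b)
        (sym (val-p-adic pp k a≡p^k*m p∤m))
  where
  p∤m*b : ¬ p ∣ m * b
  p∤m*b p∣m*b with euclidsLemma m b pp p∣m*b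
  ... | inj₁ p∣m = p∤m p∣m
  ... | inj₂ p∣b = contradiction (a⊥b (p∣a , p∣b)) (>⇒≢ (prime⇒1<p pp))

module ℤ-∏ = PrimeDivisorProduct ℤ.*-1-isCommutativeMonoid
module ℚ-∏ = PrimeDivisorProduct ℚ.*-1-isCommutativeMonoid

β-multiplicative : Multiplicative ℤ._*_ β
β-multiplicative a b 1≤a 1≤b a⊥b = ℤ-∏.⨁-primeDivisors-* (λ n p → βpow (val n p n)) 1≤a 1≤b a⊥b
  (λ {p} p∈ → let pp , p∣a = ∈-primeDivisors⁻ a p∈ in cong βpow (val-*-coprime pp p∣a 1≤a a⊥b))
  (λ {p} p∈ → let pp , p∣b = ∈-primeDivisors⁻ b p∈ in
    cong βpow (trans (cong (λ n → val n p n) (*-comm a b)) (val-*-coprime pp p∣b 1≤b (Coprime.sym a⊥b))))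

β[p^k]≡βpow[k] : Prime p → ∀ k → β (p ^ k) ≡ βpow k
β[p^k]≡βpow[k] pp zero = refl
β[p^k]≡βpow[k] {p} pp (suc k) =
  trans (ℤ-∏.⨁-primeDivisors-p^1+k pp k (λ q → βpow (val (p ^ suc k) q (p ^ suc k))))
        (cong βpow (val-p-adic pp (suc k) (sym (*-identityʳ (p ^ suc k))) (λ p∣1 → >⇒≢ (prime⇒1<p pp) (∣1⇒≡1 p∣1))))

π₂-multiplicative : Multiplicative ℚ._*_ π₂
π₂-multiplicative a b 1≤a 1≤b a⊥b =
  ℚ-∏.⨁-primeDivisors-* (λ _ → π₂factor) 1≤a 1≤b a⊥b (λ _ → refl) (λ _ → refl)

π₂[p^1+k]≡π₂factor[p] : Prime p → ∀ k → π₂ (p ^ suc k) ≡ π₂factor p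
π₂[p^1+k]≡π₂factor[p] pp k = ℚ-∏.⨁-primeDivisors-p^1+k pp k π₂factor

-- Palindromic sums and their second differences

palindromicSum : (ℕ → ℤ) → ℕ → ℤ
palindromicSum a i = ∑ (upTo (suc i)) (λ j → a (j ⊓ (i ∸ j)))

palindromicSum-suc-suc : ∀ a i → palindromicSum a (suc (suc i)) ≡ a 0 ℤ.+ (palindromicSum (a ∘ suc) i ℤ.+ a 0)
palindromicSum-suc-suc a i = begin
  palindromicSum a (suc (suc i))
    ≡⟨ ∑-upTo-suc (suc (suc i)) (λ j → a (j ⊓ (suc (suc i) ∸ j))) ⟩
  a 0 ℤ.+ ∑ (upTo (suc (suc i))) f
    ≡⟨ cong (ℤ._+_ (a 0)) (∑-upTo-∷ʳ (suc i) f) ⟩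
  a 0 ℤ.+ (∑ (upTo (suc i)) f ℤ.+ f (suc i))
    ≡⟨ cong₂ (λ s t → a 0 ℤ.+ (s ℤ.+ a (suc (suc i) ⊓ t))) (∑-upTo-cong (suc i) inner) (n∸n≡0 i) ⟩
  a 0 ℤ.+ (palindromicSum (a ∘ suc) i ℤ.+ a 0) ∎
  where
  open ≡-Reasoning
  f : ℕ → ℤ
  f j = a (suc j ⊓ (suc i ∸ j))
  inner : ∀ {j} → j < suc i → f j ≡ a (suc (j ⊓ (i ∸ j)))
  inner {j} (s≤s j≤i) = cong (λ t → a (suc j ⊓ t)) (+-∸-assoc 1 j≤i)

Δ² : (ℕ → ℤ) → ℕ → ℤ
Δ² s k = s k ℤ.- + 2 ℤ.* s (suc k) ℤ.+ s (suc (suc k))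

Δ²-shift : ∀ (s t : ℕ → ℤ) c → (∀ i → s (suc (suc i)) ≡ c ℤ.+ (t i ℤ.+ c)) →
  ∀ k → Δ² s (suc (suc k)) ≡ Δ² t k
Δ²-shift s t c s≡c+t+c k = begin
  s (2 + k) ℤ.- + 2 ℤ.* s (3 + k) ℤ.+ s (4 + k)
    ≡⟨ cong₂ ℤ._+_ (cong₂ (λ u v → u ℤ.- + 2 ℤ.* v) (s≡c+t+c k) (s≡c+t+c (1 + k))) (s≡c+t+c (2 + k)) ⟩
  (c ℤ.+ (t k ℤ.+ c)) ℤ.- + 2 ℤ.* (c ℤ.+ (t (1 + k) ℤ.+ c)) ℤ.+ (c ℤ.+ (t (2 + k) ℤ.+ c))
    ≡⟨ cancel c (t k) (t (1 + k)) (t (2 + k)) ⟩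
  t k ℤ.- + 2 ℤ.* t (1 + k) ℤ.+ t (2 + k) ∎
  where
  open ≡-Reasoning
  cancel : ∀ c u v w → (c ℤ.+ (u ℤ.+ c)) ℤ.- + 2 ℤ.* (c ℤ.+ (v ℤ.+ c)) ℤ.+ (c ℤ.+ (w ℤ.+ c))
                     ≡ u ℤ.- + 2 ℤ.* v ℤ.+ w
  cancel = solve-∀

Δ²-palindromicSum-even : ∀ a j → Δ² (palindromicSum a) (j + j) ≡ a (suc j) ℤ.- a j
Δ²-palindromicSum-even a zero = base (a 0) (a 1)
  where
  base : ∀ x y → x ℤ.+ 0ℤ ℤ.- + 2 ℤ.* (x ℤ.+ (x ℤ.+ 0ℤ)) ℤ.+ (x ℤ.+ (y ℤ.+ (x ℤ.+ 0ℤ))) ≡ y ℤ.- x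
  base = solve-∀
Δ²-palindromicSum-even a (suc j) = begin
  Δ² (palindromicSum a) (suc j + suc j)
    ≡⟨ cong (Δ² (palindromicSum a) ∘ suc) (+-suc j j) ⟩
  Δ² (palindromicSum a) (suc (suc (j + j)))
    ≡⟨ Δ²-shift (palindromicSum a) (palindromicSum (a ∘ suc)) (a 0) (palindromicSum-suc-suc a) (j + j) ⟩
  Δ² (palindromicSum (a ∘ suc)) (j + j)
    ≡⟨ Δ²-palindromicSum-even (a ∘ suc) j ⟩
  a (suc (suc j)) ℤ.- a (suc j) ∎
  where open ≡-Reasoning

Δ²-palindromicSum-odd : ∀ a j → Δ² (palindromicSum a) (suc (j + j)) ≡ 0ℤ
Δ²-palindromicSum-odd a zero = base (a 0) (a 1)
  where
  base : ∀ x y → x ℤ.+ (x ℤ.+ 0ℤ) ℤ.- + 2 ℤ.* (x ℤ.+ (y ℤ.+ (x ℤ.+ 0ℤ)))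
                 ℤ.+ (x ℤ.+ (y ℤ.+ (y ℤ.+ (x ℤ.+ 0ℤ)))) ≡ 0ℤ
  base = solve-∀
Δ²-palindromicSum-odd a (suc j) = begin
  Δ² (palindromicSum a) (suc (suc j + suc j))
    ≡⟨ cong (Δ² (palindromicSum a) ∘ suc ∘ suc) (+-suc j j) ⟩
  Δ² (palindromicSum a) (suc (suc (suc (j + j))))
    ≡⟨ Δ²-shift (palindromicSum a) (palindromicSum (a ∘ suc)) (a 0) (palindromicSum-suc-suc a) (suc (j + j)) ⟩
  Δ² (palindromicSum (a ∘ suc)) (suc (j + j))
    ≡⟨ Δ²-palindromicSum-odd (a ∘ suc) j ⟩
  0ℤ ∎
  where open ≡-Reasoning

-- Σ_{m,d} and Σ^new_{m,d}

φ∣ : ℕ → ℕ → ℕ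
φ∣ h g = if does (g ∣? h) then φ g else 0

φ∣-∣ : ∀ {g} h → g ∣ h → φ∣ h g ≡ φ g
φ∣-∣ {g} h g∣h = cong (if_then φ g else 0) (dec-true (g ∣? h) g∣h)

φ∣-∤ : ∀ {g} h → ¬ g ∣ h → φ∣ h g ≡ 0
φ∣-∤ {g} h g∤h = cong (if_then φ g else 0) (dec-false (g ∣? h) g∤h)

φ∣-* : ∀ h → 1 ≤ a → 1 ≤ b → Coprime a b → φ∣ h (a * b) ≡ φ∣ h a * φ∣ h b
φ∣-* {a} {b} h 1≤a 1≤b a⊥b with a ∣? h | b ∣? h
... | yes a∣h | yes b∣h = trans (φ∣-∣ h (coprime⇒*∣ a⊥b a∣h b∣h)) (φ-multiplicative a b 1≤a 1≤b a⊥b)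
... | no a∤h | _ = φ∣-∤ h (a∤h ∘ ∣-trans (m∣m*n b))
... | yes _ | no b∤h = trans (φ∣-∤ h (b∤h ∘ ∣-trans (n∣m*n a))) (sym (*-zeroʳ (φ a)))

∣d-m/d∣ : (m d : ℕ) .{{_ : NonZero d}} → ℕ
∣d-m/d∣ m d = ∣ + d ℤ.- + (m / d) ∣

module _ (m d : ℕ) .{{_ : NonZero d}} where

  private
    h : ℕ
    h = ∣d-m/d∣ m d

  Σmd≡∑ : ∀ n → Σmd m d n ≡ ℕ-∑.∑ (divisors n) (λ τ → φ∣ h (gcd τ (cofactor n τ)))
  Σmd≡∑ n = ℕ-∑.foldr-upTo≡∑-divisors (λ τ → φ∣ h (gcd τ (cofactor n τ))) n

  Σmd-1 : Σmd m d 1 ≡ 1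
  Σmd-1 = trans (Σmd≡∑ 1) (trans (+-identityʳ _) (φ∣-∣ h (1∣ h)))

  Σmd-multiplicative : Multiplicative _*_ (Σmd m d)
  Σmd-multiplicative = multiplicative-resp-≗ {_·_ = _*_} Σmd≡∑ (ℕ-∑.∑-divisors-multiplicative K K-*)
    where
    K : ℕ → ℕ → ℕ
    K τ σ = φ∣ h (gcd τ σ)
    K-* : Multiplicative₂ _*_ K
    K-* {x} {u} {y} {v} 1≤x _ 1≤y _ xu⊥yv =
      trans (cong (φ∣ h) (gcd[xy,uv]≡gcd[x,u]*gcd[y,v] {x} {u} {y} {v} xu⊥yv))
        (φ∣-* h (gcd[m,n]≥1 1≤x) (gcd[m,n]≥1 1≤y)
          (coprime-divisors xu⊥yv (∣-trans (gcd[m,n]∣m x u) (m∣m*n u)) (∣-trans (gcd[m,n]∣m y v) (m∣m*n v))))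

  Σnew≡∑ : ∀ n → Σnew m d n ≡ ∑ (divisors n) (λ τ → β (cofactor n τ) ℤ.* + Σmd m d τ)
  Σnew≡∑ n = ℤ-∑.foldr-upTo≡∑-divisors (λ τ → β (cofactor n τ) ℤ.* + Σmd m d τ) n

  Σnew-1 : Σnew m d 1 ≡ ℤ.1ℤ
  Σnew-1 = trans (Σnew≡∑ 1) (trans (ℤ.+-identityʳ _) (trans (ℤ.*-identityˡ _) (cong +_ Σmd-1)))

  Σnew-multiplicative : Multiplicative ℤ._*_ (Σnew m d)
  Σnew-multiplicative = multiplicative-resp-≗ {_·_ = ℤ._*_} Σnew≡∑ (ℤ-∑.∑-divisors-multiplicative K K-*)
    where
    open ≡-Reasoning
    K : ℕ → ℕ → ℤ
    K τ σ = β σ ℤ.* + Σmd m d τ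
    interchange : ∀ w x y z → (w ℤ.* x) ℤ.* (y ℤ.* z) ≡ (w ℤ.* y) ℤ.* (x ℤ.* z)
    interchange = solve-∀
    K-* : Multiplicative₂ ℤ._*_ K
    K-* {x} {u} {y} {v} 1≤x 1≤u 1≤y 1≤v xu⊥yv = begin
      β (u * v) ℤ.* + Σmd m d (x * y)
        ≡⟨ cong₂ (λ s t → s ℤ.* + t) (β-multiplicative u v 1≤u 1≤v (coprime-divisors xu⊥yv (n∣m*n x) (n∣m*n y)))
                                     (Σmd-multiplicative x y 1≤x 1≤y (coprime-divisors xu⊥yv (m∣m*n u) (m∣m*n v))) ⟩
      β u ℤ.* β v ℤ.* + (Σmd m d x * Σmd m d y)
        ≡⟨ cong (β u ℤ.* β v ℤ.*_) (ℤ.pos-* (Σmd m d x) (Σmd m d y)) ⟩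
      β u ℤ.* β v ℤ.* (+ Σmd m d x ℤ.* + Σmd m d y)
        ≡⟨ interchange (β u) (β v) (+ Σmd m d x) (+ Σmd m d y) ⟩
      K x u ℤ.* K y v ∎

βpow≥3≡0 : ∀ {n} → 3 ≤ n → βpow n ≡ 0ℤ
βpow≥3≡0 {suc (suc (suc n))} _ = refl
βpow≥3≡0 {suc zero} (s≤s ())
βpow≥3≡0 {suc (suc zero)} (s≤s (s≤s ()))

even-or-odd : ∀ k → ∃ λ j → k ≡ j + j ⊎ k ≡ suc (j + j)
even-or-odd zero = 0 , inj₁ refl
even-or-odd (suc k) with even-or-odd k
... | j , inj₁ k≡j+j = j , inj₂ (cong suc k≡j+j)
... | j , inj₂ k≡1+j+j = suc j , inj₁ (trans (cong suc k≡1+j+j) (cong suc (sym (+-suc j j))))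

module _ (m d : ℕ) .{{_ : NonZero d}} {p} (pp : Prime p) where

  private
    h : ℕ
    h = ∣d-m/d∣ m d

  φ∣[p^_] : ℕ → ℤ
  φ∣[p^ t ] = + φ∣ h (p ^ t)

  Σmd[p^i]≡palindromicSum : ∀ i → + Σmd m d (p ^ i) ≡ palindromicSum φ∣[p^_] i
  Σmd[p^i]≡palindromicSum i = begin
    + Σmd m d (p ^ i)                      ≡⟨ cong +_ (Σmd≡∑ m d (p ^ i)) ⟩
    + ℕ-∑.∑ (divisors (p ^ i)) F           ≡⟨ +-∑ (divisors (p ^ i)) F ⟩
    ∑ (divisors (p ^ i)) (+_ ∘ F)          ≡⟨ ∑-divisors-p^k pp i (+_ ∘ F) ⟩
    ∑ (upTo (suc i)) (λ j → + F (p ^ j))   ≡⟨ ∑-upTo-cong (suc i) gcd≡ ⟩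
    palindromicSum φ∣[p^_] i               ∎
    where
    open ≡-Reasoning
    F : ℕ → ℕ
    F τ = φ∣ h (gcd τ (cofactor (p ^ i) τ))
    gcd≡ : ∀ {j} → j < suc i → + F (p ^ j) ≡ φ∣[p^ j ⊓ (i ∸ j) ]
    gcd≡ {j} (s≤s j≤i) = cong (λ g → + φ∣ h g)
      (trans (cong (gcd (p ^ j)) (cofactor-p^k pp j≤i)) (gcd[p^i,p^j]≡p^[i⊓j] pp j (i ∸ j)))

  Σnew[p^k]≡ : ∀ k → Σnew m d (p ^ k) ≡ ∑ (upTo (suc k)) (λ i → βpow (k ∸ i) ℤ.* palindromicSum φ∣[p^_] i)
  Σnew[p^k]≡ k = begin
    Σnew m d (p ^ k)
      ≡⟨ Σnew≡∑ m d (p ^ k) ⟩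
    ∑ (divisors (p ^ k)) (λ τ → β (cofactor (p ^ k) τ) ℤ.* + Σmd m d τ)
      ≡⟨ ∑-divisors-p^k pp k (λ τ → β (cofactor (p ^ k) τ) ℤ.* + Σmd m d τ) ⟩
    ∑ (upTo (suc k)) (λ i → β (cofactor (p ^ k) (p ^ i)) ℤ.* + Σmd m d (p ^ i))
      ≡⟨ ∑-upTo-cong (suc k) summand≡ ⟩
    ∑ (upTo (suc k)) (λ i → βpow (k ∸ i) ℤ.* palindromicSum φ∣[p^_] i) ∎
    where
    open ≡-Reasoning
    summand≡ : ∀ {i} → i < suc k →
      β (cofactor (p ^ k) (p ^ i)) ℤ.* + Σmd m d (p ^ i) ≡ βpow (k ∸ i) ℤ.* palindromicSum φ∣[p^_] i
    summand≡ {i} (s≤s i≤k) = cong₂ ℤ._*_ (trans (cong β (cofactor-p^k pp i≤k)) (β[p^k]≡βpow[k] pp (k ∸ i)))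
                                         (Σmd[p^i]≡palindromicSum i)

  Σnew[p]≡0 : Σnew m d (p ^ 1) ≡ 0ℤ
  Σnew[p]≡0 = trans (Σnew[p^k]≡ 1) (cancel φ∣[p^ 0 ])
    where
    cancel : ∀ x → ℤ.- + 2 ℤ.* (x ℤ.+ 0ℤ) ℤ.+ (ℤ.1ℤ ℤ.* (x ℤ.+ (x ℤ.+ 0ℤ)) ℤ.+ 0ℤ) ≡ 0ℤ
    cancel = solve-∀

  Σnew[p^2+k]≡Δ² : ∀ k → Σnew m d (p ^ suc (suc k)) ≡ Δ² (palindromicSum φ∣[p^_]) k
  Σnew[p^2+k]≡Δ² k = begin
    Σnew m d (p ^ suc (suc k))
      ≡⟨ Σnew[p^k]≡ (suc (suc k)) ⟩
    ∑ (upTo (3 + k)) term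
      ≡⟨ ∑-upTo-∷ʳ (2 + k) term ⟩
    ∑ (upTo (2 + k)) term ℤ.+ term (2 + k)
      ≡⟨ cong (ℤ._+ term (2 + k)) (∑-upTo-∷ʳ (1 + k) term) ⟩
    ∑ (upTo (1 + k)) term ℤ.+ term (1 + k) ℤ.+ term (2 + k)
      ≡⟨ cong (λ s → s ℤ.+ term (1 + k) ℤ.+ term (2 + k)) (∑-upTo-∷ʳ k term) ⟩
    ∑ (upTo k) term ℤ.+ term k ℤ.+ term (1 + k) ℤ.+ term (2 + k)
      ≡⟨ cong₂ ℤ._+_ (cong₂ ℤ._+_ (cong₂ ℤ._+_ (∑-upTo-0# k early) term[k]) term[1+k]) term[2+k] ⟩
    0ℤ ℤ.+ S k ℤ.- + 2 ℤ.* S (1 + k) ℤ.+ S (2 + k)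
      ≡⟨ cong (λ s → s ℤ.- + 2 ℤ.* S (1 + k) ℤ.+ S (2 + k)) (ℤ.+-identityˡ (S k)) ⟩
    Δ² S k ∎
    where
    open ≡-Reasoning
    S : ℕ → ℤ
    S = palindromicSum φ∣[p^_]
    term : ℕ → ℤ
    term i = βpow (2 + k ∸ i) ℤ.* S i
    early : ∀ {i} → i < k → term i ≡ 0ℤ
    early {i} i<k = trans (cong (ℤ._* S i) (βpow≥3≡0 (m+n≤o⇒m≤o∸n 3 (+-monoʳ-≤ 2 i<k)))) (ℤ.*-zeroˡ (S i))
    term[k] : term k ≡ S k
    term[k] = trans (cong (λ e → βpow e ℤ.* S k) (m+n∸n≡m 2 k)) (ℤ.*-identityˡ (S k))
    term[1+k] : term (1 + k) ≡ ℤ.- (+ 2 ℤ.* S (1 + k))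
    term[1+k] = trans (cong (λ e → βpow e ℤ.* S (1 + k)) (m+n∸n≡m 1 k)) (sym (ℤ.neg-distribˡ-* (+ 2) (S (1 + k))))
    term[2+k] : term (2 + k) ≡ S (2 + k)
    term[2+k] = trans (cong (λ e → βpow e ℤ.* S (2 + k)) (n∸n≡0 k)) (ℤ.*-identityˡ (S (2 + k)))

  Σnew[p^1+k]-cases : ∀ k → Σnew m d (p ^ suc k) ≡ 0ℤ
    ⊎ ∃ λ j → suc k ≡ suc j + suc j × Σnew m d (p ^ suc k) ≡ φ∣[p^ suc j ] ℤ.- φ∣[p^ j ]
  Σnew[p^1+k]-cases zero = inj₁ Σnew[p]≡0
  Σnew[p^1+k]-cases (suc k) with even-or-odd k
  ... | j , inj₁ refl =
    inj₂ (j , cong suc (sym (+-suc j j)) , trans (Σnew[p^2+k]≡Δ² (j + j)) (Δ²-palindromicSum-even φ∣[p^_] j))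
  ... | j , inj₂ refl = inj₁ (trans (Σnew[p^2+k]≡Δ² (suc (j + j))) (Δ²-palindromicSum-odd φ∣[p^_] j))

-- Bounds

∣+x-+y∣≤ : ∀ {x y b} → x ≤ b → y ≤ b → ∣ + x ℤ.- + y ∣ ≤ b
∣+x-+y∣≤ {x} {y} x≤b y≤b =
  subst (_≤ _) (cong ∣_∣ (sym (ℤ.m-n≡m⊖n x y))) (≤-trans (ℤ.∣m⊝n∣≤m⊔n x y) (⊔-lub x≤b y≤b))

φ∣≤gcd : ∀ {g n} h → g ∣ n → .{{NonZero n}} → φ∣ h g ≤ gcd n h
φ∣≤gcd {g} {n} h g∣n with g ∣? h
... | no _ = z≤n
... | yes g∣h = ≤-trans (φ[n]≤n g) (∣⇒≤ {{gcd≢0ˡ n h}} (gcd-greatest g∣n g∣h))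

module _ (m d : ℕ) .{{_ : NonZero d}} where

  private
    h : ℕ
    h = ∣d-m/d∣ m d

  ∣Σnew∣≤gcd : ∀ n → 1 ≤ n → ∣ Σnew m d n ∣ ≤ gcd n h
  ∣Σnew∣≤gcd = multiplicative-induction (λ n → ∣ Σnew m d n ∣ ≤ gcd n h) base prime-power product
    where
    base : ∣ Σnew m d 1 ∣ ≤ gcd 1 h
    base = subst₂ _≤_ (sym (cong ∣_∣ (Σnew-1 m d))) (sym (gcd-zeroˡ h)) ≤-refl
    prime-power : ∀ {p} k → Prime p → ∣ Σnew m d (p ^ suc k) ∣ ≤ gcd (p ^ suc k) h
    prime-power {p} k pp with Σnew[p^1+k]-cases m d pp k
    ... | inj₁ Σnew≡0 = subst (λ z → ∣ z ∣ ≤ gcd (p ^ suc k) h) (sym Σnew≡0) z≤n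
    ... | inj₂ (j , 1+k≡2+2j , Σnew≡) = subst (λ z → ∣ z ∣ ≤ gcd (p ^ suc k) h) (sym Σnew≡)
      (∣+x-+y∣≤ (φ∣≤gcd h (p^i∣p^j pp 1+j≤1+k)) (φ∣≤gcd h (p^i∣p^j pp (≤-trans (n≤1+n j) 1+j≤1+k))))
      where
      instance
        p^1+k≢0 : NonZero (p ^ suc k)
        p^1+k≢0 = m^n≢0 p (suc k) {{prime⇒nonZero pp}}
      1+j≤1+k : suc j ≤ suc k
      1+j≤1+k = subst (suc j ≤_) (sym 1+k≡2+2j) (m≤m+n (suc j) (suc j))
    product : ∀ {a b} → 1 ≤ a → 1 ≤ b → Coprime a b →
      ∣ Σnew m d a ∣ ≤ gcd a h → ∣ Σnew m d b ∣ ≤ gcd b h → ∣ Σnew m d (a * b) ∣ ≤ gcd (a * b) h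
    product {a} {b} 1≤a 1≤b a⊥b ∣Σa∣≤ ∣Σb∣≤ = begin
      ∣ Σnew m d (a * b) ∣                 ≡⟨ cong ∣_∣ (Σnew-multiplicative m d a b 1≤a 1≤b a⊥b) ⟩
      ∣ Σnew m d a ℤ.* Σnew m d b ∣        ≡⟨ ℤ.abs-* (Σnew m d a) (Σnew m d b) ⟩
      ∣ Σnew m d a ∣ * ∣ Σnew m d b ∣      ≤⟨ *-mono-≤ ∣Σa∣≤ ∣Σb∣≤ ⟩
      gcd a h * gcd b h                    ≤⟨ ∣⇒≤ {{gcd≢0ˡ (a * b) h}} (gcd[a,n]*gcd[b,n]∣gcd[a*b,n] a⊥b) ⟩
      gcd (a * b) h                        ∎
      where
      open ≤-Reasoning
      instance
        ab≢0 : NonZero (a * b)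
        ab≢0 = m*n≢0 a b {{>-nonZero 1≤a}} {{>-nonZero 1≤b}}

module _ {p} (pp : Prime p) where

  private instance
    p≢0 : NonZero p
    p≢0 = prime⇒nonZero pp

  φ[p^1+j]≤p*φ[p^j] : ∀ j → φ (p ^ suc j) ≤ p * φ (p ^ j)
  φ[p^1+j]≤p*φ[p^j] zero = begin
    φ (p ^ 1)      ≡⟨ φ[p^1+k]≡p^k*[p∸1] pp 0 ⟩
    1 * (p ∸ 1)    ≡⟨ *-identityˡ (p ∸ 1) ⟩
    p ∸ 1          ≤⟨ m∸n≤m p 1 ⟩
    p              ≡⟨ *-identityʳ p ⟨
    p * φ 1        ∎
    where open ≤-Reasoning
  φ[p^1+j]≤p*φ[p^j] (suc j) = ≤-reflexive (begin
    φ (p ^ suc (suc j))         ≡⟨ φ[p^1+k]≡p^k*[p∸1] pp (suc j) ⟩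
    p * p ^ j * (p ∸ 1)         ≡⟨ *-assoc p (p ^ j) (p ∸ 1) ⟩
    p * (p ^ j * (p ∸ 1))       ≡⟨ cong (p *_) (φ[p^1+k]≡p^k*[p∸1] pp j) ⟨
    p * φ (p ^ suc j)           ∎)
    where open ≡-Reasoning

  φ[p^j]≤φ[p^1+j] : ∀ j → φ (p ^ j) ≤ φ (p ^ suc j)
  φ[p^j]≤φ[p^1+j] j = begin
    φ (p ^ j)              ≤⟨ φ[n]≤n (p ^ j) ⟩
    p ^ j                  ≤⟨ m≤m*n (p ^ j) (p ∸ 1) {{>-nonZero (m<n⇒0<n∸m (prime⇒1<p pp))}} ⟩
    p ^ j * (p ∸ 1)        ≡⟨ φ[p^1+k]≡p^k*[p∸1] pp j ⟨
    φ (p ^ suc j)          ∎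
    where open ≤-Reasoning

[y∸x]*p≤y*[p∸1] : ∀ {x y p} → y ≤ x * p → (y ∸ x) * p ≤ y * (p ∸ 1)
[y∸x]*p≤y*[p∸1] {x} {y} {p} y≤xp = begin
  (y ∸ x) * p     ≡⟨ *-distribʳ-∸ p y x ⟩
  y * p ∸ x * p   ≤⟨ ∸-monoʳ-≤ (y * p) y≤xp ⟩
  y * p ∸ y       ≡⟨ cong (y * p ∸_) (*-identityʳ y) ⟨
  y * p ∸ y * 1   ≡⟨ *-distribˡ-∸ y p 1 ⟨
  y * (p ∸ 1)     ∎
  where open ≤-Reasoning

s*q≤y*y⇒s²[q²]³≤[qy]⁴ : ∀ s q y → s * q ≤ y * y → s ^ 2 * (q * q) ^ 3 ≤ (q * y) ^ 4
s*q≤y*y⇒s²[q²]³≤[qy]⁴ s q y sq≤yy =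
  subst₂ _≤_ (lhs s q) (rhs q y) (*-monoˡ-≤ (q ^ 4) (^-monoˡ-≤ 2 sq≤yy))
  where
  open ℕ-Solver using (solve; _:*_; _:^_; _:=_)
  lhs : ∀ s q → (s * q) ^ 2 * q ^ 4 ≡ s ^ 2 * (q * q) ^ 3
  lhs = solve 2 (λ s q → (s :* q) :^ 2 :* q :^ 4 := s :^ 2 :* (q :* q) :^ 3) refl
  rhs : ∀ q y → (y * y) ^ 2 * q ^ 4 ≡ (q * y) ^ 4
  rhs = solve 2 (λ q y → (y :* y) :^ 2 :* q :^ 4 := (q :* y) :^ 4) refl

φ[p^_]-increment-bound : Prime p → ∀ j →
  (φ (p ^ suc j) ∸ φ (p ^ j)) ^ 2 * (p ^ (suc j + suc j)) ^ 3 ≤ φ (p ^ (suc j + suc j)) ^ 4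
φ[p^_]-increment-bound {p} pp j = begin
  (φⱼ₊₁ ∸ φⱼ) ^ 2 * (p ^ (suc j + suc j)) ^ 3
    ≡⟨ cong (λ N → (φⱼ₊₁ ∸ φⱼ) ^ 2 * N ^ 3) (^-distribˡ-+-* p (suc j) (suc j)) ⟩
  (φⱼ₊₁ ∸ φⱼ) ^ 2 * (q * q) ^ 3
    ≤⟨ s*q≤y*y⇒s²[q²]³≤[qy]⁴ (φⱼ₊₁ ∸ φⱼ) q φⱼ₊₁ [φⱼ₊₁∸φⱼ]*q≤φⱼ₊₁*φⱼ₊₁ ⟩
  (q * φⱼ₊₁) ^ 4
    ≡⟨ cong (_^ 4) φ[p^[2+2j]]≡q*φⱼ₊₁ ⟨
  φ (p ^ (suc j + suc j)) ^ 4 ∎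
  where
  open ≤-Reasoning
  φⱼ φⱼ₊₁ q : ℕ
  φⱼ = φ (p ^ j)
  φⱼ₊₁ = φ (p ^ suc j)
  q = p ^ suc j
  φⱼ₊₁≡p^j*[p∸1] : φⱼ₊₁ ≡ p ^ j * (p ∸ 1)
  φⱼ₊₁≡p^j*[p∸1] = φ[p^1+k]≡p^k*[p∸1] pp j
  φⱼ₊₁≤φⱼ*p : φⱼ₊₁ ≤ φⱼ * p
  φⱼ₊₁≤φⱼ*p = subst (φⱼ₊₁ ≤_) (*-comm p φⱼ) (φ[p^1+j]≤p*φ[p^j] pp j)
  φ[p^[2+2j]]≡q*φⱼ₊₁ : φ (p ^ (suc j + suc j)) ≡ q * φⱼ₊₁
  φ[p^[2+2j]]≡q*φⱼ₊₁ = begin-equality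
    φ (p ^ suc (j + suc j))      ≡⟨ φ[p^1+k]≡p^k*[p∸1] pp (j + suc j) ⟩
    p ^ (j + suc j) * (p ∸ 1)    ≡⟨ cong (λ e → p ^ e * (p ∸ 1)) (+-comm j (suc j)) ⟩
    p ^ (suc j + j) * (p ∸ 1)    ≡⟨ cong (_* (p ∸ 1)) (^-distribˡ-+-* p (suc j) j) ⟩
    q * p ^ j * (p ∸ 1)          ≡⟨ *-assoc q (p ^ j) (p ∸ 1) ⟩
    q * (p ^ j * (p ∸ 1))        ≡⟨ cong (q *_) φⱼ₊₁≡p^j*[p∸1] ⟨
    q * φⱼ₊₁                     ∎
  [φⱼ₊₁∸φⱼ]*q≤φⱼ₊₁*φⱼ₊₁ : (φⱼ₊₁ ∸ φⱼ) * q ≤ φⱼ₊₁ * φⱼ₊₁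
  [φⱼ₊₁∸φⱼ]*q≤φⱼ₊₁*φⱼ₊₁ = begin
    (φⱼ₊₁ ∸ φⱼ) * (p * p ^ j)
      ≡⟨ *-assoc (φⱼ₊₁ ∸ φⱼ) p (p ^ j) ⟨
    (φⱼ₊₁ ∸ φⱼ) * p * p ^ j
      ≤⟨ *-monoˡ-≤ (p ^ j) ([y∸x]*p≤y*[p∸1] {φⱼ} {φⱼ₊₁} {p} φⱼ₊₁≤φⱼ*p) ⟩
    φⱼ₊₁ * (p ∸ 1) * p ^ j
      ≡⟨ *-assoc φⱼ₊₁ (p ∸ 1) (p ^ j) ⟩
    φⱼ₊₁ * ((p ∸ 1) * p ^ j)
      ≡⟨ cong (φⱼ₊₁ *_) (trans (*-comm (p ∸ 1) (p ^ j)) (sym φⱼ₊₁≡p^j*[p∸1])) ⟩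
    φⱼ₊₁ * φⱼ₊₁ ∎

module _ (m d : ℕ) .{{_ : NonZero d}} (h≡0 : ∣d-m/d∣ m d ≡ 0) where

  private
    h : ℕ
    h = ∣d-m/d∣ m d

  ∣Σnew[p^1+k]∣²*p^[1+k]³≤φ⁴ : Prime p → ∀ k →
    ∣ Σnew m d (p ^ suc k) ∣ ^ 2 * (p ^ suc k) ^ 3 ≤ φ (p ^ suc k) ^ 4
  ∣Σnew[p^1+k]∣²*p^[1+k]³≤φ⁴ {p} pp k with Σnew[p^1+k]-cases m d pp k
  ... | inj₁ Σnew≡0 = subst (λ z → ∣ z ∣ ^ 2 * (p ^ suc k) ^ 3 ≤ φ (p ^ suc k) ^ 4) (sym Σnew≡0) z≤n
  ... | inj₂ (j , 1+k≡2+2j , Σnew≡) = begin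
    ∣ Σnew m d (p ^ suc k) ∣ ^ 2 * (p ^ suc k) ^ 3
      ≡⟨ cong₂ (λ s e → s ^ 2 * (p ^ e) ^ 3) ∣Σnew∣≡ 1+k≡2+2j ⟩
    (φ (p ^ suc j) ∸ φ (p ^ j)) ^ 2 * (p ^ (suc j + suc j)) ^ 3
      ≤⟨ φ[p^_]-increment-bound pp j ⟩
    φ (p ^ (suc j + suc j)) ^ 4
      ≡⟨ cong (λ e → φ (p ^ e) ^ 4) 1+k≡2+2j ⟨
    φ (p ^ suc k) ^ 4 ∎
    where
    open ≤-Reasoning
    φ∣≡φ : ∀ t → φ∣ h (p ^ t) ≡ φ (p ^ t)
    φ∣≡φ t = φ∣-∣ h (subst (p ^ t ∣_) (sym h≡0) ((p ^ t) ∣0))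
    ∣Σnew∣≡ : ∣ Σnew m d (p ^ suc k) ∣ ≡ φ (p ^ suc j) ∸ φ (p ^ j)
    ∣Σnew∣≡ = begin-equality
      ∣ Σnew m d (p ^ suc k) ∣                        ≡⟨ cong ∣_∣ Σnew≡ ⟩
      ∣ + φ∣ h (p ^ suc j) ℤ.- + φ∣ h (p ^ j) ∣       ≡⟨ cong₂ (λ u v → ∣ + u ℤ.- + v ∣) (φ∣≡φ (suc j)) (φ∣≡φ j) ⟩
      ∣ + φ (p ^ suc j) ℤ.- + φ (p ^ j) ∣             ≡⟨ cong ∣_∣ (ℤ.m-n≡m⊖n (φ (p ^ suc j)) (φ (p ^ j))) ⟩
      ∣ φ (p ^ suc j) ℤ.⊖ φ (p ^ j) ∣                 ≡⟨ cong ∣_∣ (ℤ.⊖-≥ (φ[p^j]≤φ[p^1+j] pp j)) ⟩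
      φ (p ^ suc j) ∸ φ (p ^ j)                       ∎

  ∣Σnew∣²*n³≤φ⁴ : ∀ n → 1 ≤ n → ∣ Σnew m d n ∣ ^ 2 * n ^ 3 ≤ φ n ^ 4
  ∣Σnew∣²*n³≤φ⁴ = multiplicative-induction Q base (λ k pp → ∣Σnew[p^1+k]∣²*p^[1+k]³≤φ⁴ pp k) product
    where
    Q : ℕ → Set
    Q n = ∣ Σnew m d n ∣ ^ 2 * n ^ 3 ≤ φ n ^ 4
    base : Q 1
    base = subst (λ s → s ^ 2 * 1 ≤ 1) (sym (cong ∣_∣ (Σnew-1 m d))) ≤-refl
    product : ∀ {a b} → 1 ≤ a → 1 ≤ b → Coprime a b → Q a → Q b → Q (a * b)
    product {a} {b} 1≤a 1≤b a⊥b Qa Qb = subst₂ _≤_ (sym lhs) (sym rhs) (*-mono-≤ Qa Qb)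
      where
      open ℕ-Solver using (solve; _:*_; _:^_; _:=_)
      interchange : ∀ s t a b → (s * t) ^ 2 * (a * b) ^ 3 ≡ s ^ 2 * a ^ 3 * (t ^ 2 * b ^ 3)
      interchange = solve 4 (λ s t a b → (s :* t) :^ 2 :* (a :* b) :^ 3 := s :^ 2 :* a :^ 3 :* (t :^ 2 :* b :^ 3))
                            refl
      distrib⁴ : ∀ x y → (x * y) ^ 4 ≡ x ^ 4 * y ^ 4
      distrib⁴ = solve 2 (λ x y → (x :* y) :^ 4 := x :^ 4 :* y :^ 4) refl
      ∣Σnew[ab]∣≡ : ∣ Σnew m d (a * b) ∣ ≡ ∣ Σnew m d a ∣ * ∣ Σnew m d b ∣
      ∣Σnew[ab]∣≡ = trans (cong ∣_∣ (Σnew-multiplicative m d a b 1≤a 1≤b a⊥b)) (ℤ.abs-* (Σnew m d a) (Σnew m d b))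
      lhs : ∣ Σnew m d (a * b) ∣ ^ 2 * (a * b) ^ 3 ≡ ∣ Σnew m d a ∣ ^ 2 * a ^ 3 * (∣ Σnew m d b ∣ ^ 2 * b ^ 3)
      lhs = trans (cong (λ s → s ^ 2 * (a * b) ^ 3) ∣Σnew[ab]∣≡) (interchange ∣ Σnew m d a ∣ ∣ Σnew m d b ∣ a b)
      rhs : φ (a * b) ^ 4 ≡ φ a ^ 4 * φ b ^ 4
      rhs = trans (cong (_^ 4) (φ-multiplicative a b 1≤a 1≤b a⊥b)) (distrib⁴ (φ a) (φ b))

-- Passing to ℚ

fromℕ : ℕ → ℚ
fromℕ n = + n ℚ./ 1

fromℕ≡mkℚ : ∀ n → fromℕ n ≡ mkℚ (+ n) 0 (Coprime.sym (Coprime.1-coprimeTo n))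
fromℕ≡mkℚ n = ℚ.normalize-coprime (Coprime.sym (Coprime.1-coprimeTo n))

fromℕ-* : ∀ a b → fromℕ (a * b) ≡ fromℕ a ℚ.* fromℕ b
fromℕ-* a b = trans (cong (ℚ._/ 1) (ℤ.pos-* a b)) (sym (cong₂ ℚ._*_ (fromℕ≡mkℚ a) (fromℕ≡mkℚ b)))

fromℕ-+ : ∀ a b → fromℕ (a + b) ≡ fromℕ a ℚ.+ fromℕ b
fromℕ-+ a b =
  trans (cong (ℚ._/ 1) (trans (ℤ.pos-+ a b) (sym (cong₂ ℤ._+_ (ℤ.*-identityʳ (+ a)) (ℤ.*-identityʳ (+ b))))))
        (sym (cong₂ ℚ._+_ (fromℕ≡mkℚ a) (fromℕ≡mkℚ b)))

fromℕ-^ : ∀ a k → fromℕ (a ^ k) ≡ fromℕ a ^ℚ k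
fromℕ-^ a zero = refl
fromℕ-^ a (suc k) = trans (fromℕ-* a (a ^ k)) (cong (fromℕ a ℚ.*_) (fromℕ-^ a k))

fromℕ-mono-≤ : ∀ {a b} → a ≤ b → fromℕ a ℚ.≤ fromℕ b
fromℕ-mono-≤ {a} {b} a≤b = subst₂ ℚ._≤_ (sym (fromℕ≡mkℚ a)) (sym (fromℕ≡mkℚ b))
  (ℚ.*≤* (ℤ.*-monoʳ-≤-nonNeg (+ 1) (ℤ.+≤+ a≤b)))

fromℕ-positive : ∀ {n} → 1 ≤ n → ℚ.Positive (fromℕ n)
fromℕ-positive {suc n} _ = subst ℚ.Positive (sym (fromℕ≡mkℚ (suc n))) _

∣z/1∣≡fromℕ∣z∣ : ∀ z → ℚ.∣ z ℚ./ 1 ∣ ≡ fromℕ ∣ z ∣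
∣z/1∣≡fromℕ∣z∣ (+ n) = trans (cong ℚ.∣_∣ (fromℕ≡mkℚ n)) (sym (fromℕ≡mkℚ n))
∣z/1∣≡fromℕ∣z∣ -[1+ n ] =
  trans (cong (λ q → ℚ.∣ ℚ.- q ∣) (fromℕ≡mkℚ (suc n))) (sym (fromℕ≡mkℚ (suc n)))

π₂factor[2+r]*[1+r]≡2+r : ∀ r → π₂factor (suc (suc r)) ℚ.* fromℕ (suc r) ≡ fromℕ (suc (suc r))
π₂factor[2+r]*[1+r]≡2+r r = begin
  (ℚ.1ℚ ℚ.+ (+ 1 ℚ./ suc r)) ℚ.* fromℕ (suc r)
    ≡⟨ ℚ.*-distribʳ-+ (fromℕ (suc r)) ℚ.1ℚ (+ 1 ℚ./ suc r) ⟩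
  ℚ.1ℚ ℚ.* fromℕ (suc r) ℚ.+ (+ 1 ℚ./ suc r) ℚ.* fromℕ (suc r)
    ≡⟨ cong₂ ℚ._+_ (ℚ.*-identityˡ (fromℕ (suc r))) inverse ⟩
  fromℕ (suc r) ℚ.+ fromℕ 1
    ≡⟨ fromℕ-+ (suc r) 1 ⟨
  fromℕ (suc r + 1)
    ≡⟨ cong fromℕ (+-comm (suc r) 1) ⟩
  fromℕ (suc (suc r)) ∎
  where
  open ≡-Reasoning
  inverse : (+ 1 ℚ./ suc r) ℚ.* fromℕ (suc r) ≡ ℚ.1ℚ
  inverse = trans (cong₂ ℚ._*_ (ℚ.normalize-coprime (Coprime.1-coprimeTo (suc r))) (fromℕ≡mkℚ (suc r)))
                  (ℚ.*-inverseˡ (mkℚ (+ suc r) 0 (Coprime.sym (Coprime.1-coprimeTo (suc r)))))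

π₂*φ≡id : ∀ n → 1 ≤ n → π₂ n ℚ.* fromℕ (φ n) ≡ fromℕ n
π₂*φ≡id = multiplicative-induction Q (ℚ.*-identityˡ (fromℕ 1)) prime-power product
  where
  open ≡-Reasoning
  Q : ℕ → Set
  Q n = π₂ n ℚ.* fromℕ (φ n) ≡ fromℕ n
  prime-power : ∀ {p} k → Prime p → Q (p ^ suc k)
  prime-power {zero} k pp = contradiction (prime⇒1<p pp) λ ()
  prime-power {suc zero} k pp = contradiction (prime⇒1<p pp) λ { (s≤s ()) }
  prime-power {p@(suc (suc r))} k pp = begin
    π₂ (p ^ suc k) ℚ.* fromℕ (φ (p ^ suc k))
      ≡⟨ cong₂ ℚ._*_ (π₂[p^1+k]≡π₂factor[p] pp k)
                     (trans (cong fromℕ (φ[p^1+k]≡p^k*[p∸1] pp k)) (fromℕ-* (p ^ k) (suc r))) ⟩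
    π₂factor p ℚ.* (fromℕ (p ^ k) ℚ.* fromℕ (suc r))
      ≡⟨ ℚ*-x∙yz≈y∙xz (π₂factor p) (fromℕ (p ^ k)) (fromℕ (suc r)) ⟩
    fromℕ (p ^ k) ℚ.* (π₂factor p ℚ.* fromℕ (suc r))
      ≡⟨ cong (fromℕ (p ^ k) ℚ.*_) (π₂factor[2+r]*[1+r]≡2+r r) ⟩
    fromℕ (p ^ k) ℚ.* fromℕ p
      ≡⟨ fromℕ-* (p ^ k) p ⟨
    fromℕ (p ^ k * p)
      ≡⟨ cong fromℕ (*-comm (p ^ k) p) ⟩
    fromℕ (p ^ suc k) ∎
  product : ∀ {a b} → 1 ≤ a → 1 ≤ b → Coprime a b → Q a → Q b → Q (a * b)
  product {a} {b} 1≤a 1≤b a⊥b πφa πφb = begin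
    π₂ (a * b) ℚ.* fromℕ (φ (a * b))
      ≡⟨ cong₂ ℚ._*_ (π₂-multiplicative a b 1≤a 1≤b a⊥b)
                     (trans (cong fromℕ (φ-multiplicative a b 1≤a 1≤b a⊥b)) (fromℕ-* (φ a) (φ b))) ⟩
    (π₂ a ℚ.* π₂ b) ℚ.* (fromℕ (φ a) ℚ.* fromℕ (φ b))
      ≡⟨ ℚ*-interchange (π₂ a) (π₂ b) (fromℕ (φ a)) (fromℕ (φ b)) ⟩
    (π₂ a ℚ.* fromℕ (φ a)) ℚ.* (π₂ b ℚ.* fromℕ (φ b))
      ≡⟨ cong₂ ℚ._*_ πφa πφb ⟩
    fromℕ a ℚ.* fromℕ b
      ≡⟨ fromℕ-* a b ⟨
    fromℕ (a * b) ∎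

ℕ-bound⇒ℚ-bound : ∀ s n f (π : ℚ) → 1 ≤ f → π ℚ.* fromℕ f ≡ fromℕ n → s ^ 2 * n ^ 3 ≤ f ^ 4 →
  (fromℕ s ℚ.* (π ℚ.* π)) ℚ.* (fromℕ s ℚ.* (π ℚ.* π)) ℚ.≤ fromℕ n
ℕ-bound⇒ℚ-bound s n f π 1≤f π*f≡n s²n³≤f⁴ = ℚ.*-cancelʳ-≤-pos (fromℕ (f ^ 4)) {{f⁴>0}} (begin
  L ℚ.* fromℕ (f ^ 4)                         ≡⟨ cong (L ℚ.*_) (fromℕ-^ f 4) ⟩
  L ℚ.* fromℕ f ^ℚ 4                          ≡⟨ gather (fromℕ s) π (fromℕ f) ⟩
  fromℕ s ^ℚ 2 ℚ.* (π ℚ.* fromℕ f) ^ℚ 4       ≡⟨ cong (λ t → fromℕ s ^ℚ 2 ℚ.* t ^ℚ 4) π*f≡n ⟩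
  fromℕ s ^ℚ 2 ℚ.* fromℕ n ^ℚ 4               ≡⟨ split (fromℕ s) (fromℕ n) ⟩
  fromℕ s ^ℚ 2 ℚ.* fromℕ n ^ℚ 3 ℚ.* fromℕ n   ≡⟨ cong (ℚ._* fromℕ n) fromℕ[s²n³] ⟨
  fromℕ (s ^ 2 * n ^ 3) ℚ.* fromℕ n           ≤⟨ ℚ.*-monoʳ-≤-nonNeg (fromℕ n) {{n≥0}} (fromℕ-mono-≤ s²n³≤f⁴) ⟩
  fromℕ (f ^ 4) ℚ.* fromℕ n                   ≡⟨ ℚ.*-comm (fromℕ (f ^ 4)) (fromℕ n) ⟩
  fromℕ n ℚ.* fromℕ (f ^ 4)                   ∎)
  where
  open ℚ.≤-Reasoning
  L : ℚ
  L = (fromℕ s ℚ.* (π ℚ.* π)) ℚ.* (fromℕ s ℚ.* (π ℚ.* π))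
  f⁴>0 : ℚ.Positive (fromℕ (f ^ 4))
  f⁴>0 = fromℕ-positive (m^n>0 f {{>-nonZero 1≤f}} 4)
  n≥0 : ℚ.NonNegative (fromℕ n)
  n≥0 = subst ℚ.NonNegative (sym (fromℕ≡mkℚ n)) _
  fromℕ[s²n³] : fromℕ (s ^ 2 * n ^ 3) ≡ fromℕ s ^ℚ 2 ℚ.* fromℕ n ^ℚ 3
  fromℕ[s²n³] = trans (fromℕ-* (s ^ 2) (n ^ 3)) (cong₂ ℚ._*_ (fromℕ-^ s 2) (fromℕ-^ n 3))
  open ℚ-Solver using (solve; _:*_; _:^_; _:=_)
  gather : ∀ x p y → (x ℚ.* (p ℚ.* p)) ℚ.* (x ℚ.* (p ℚ.* p)) ℚ.* y ^ℚ 4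
                     ≡ x ^ℚ 2 ℚ.* (p ℚ.* y) ^ℚ 4
  gather = solve 3 (λ x p y → (x :* (p :* p)) :* (x :* (p :* p)) :* y :^ 4 := x :^ 2 :* (p :* y) :^ 4) refl
  split : ∀ x y → x ^ℚ 2 ℚ.* y ^ℚ 4 ≡ x ^ℚ 2 ℚ.* y ^ℚ 3 ℚ.* y
  split = solve 2 (λ x y → x :^ 2 :* y :^ 4 := x :^ 2 :* y :^ 3 :* y) refl

lemma3p5 : (m d : ℕ) .{{_ : NonZero d}} → 1 ≤ m → d ∣ m →
  (Σmd m d 1 ≡ 1 ×
    ((a b : ℕ) → 1 ≤ a → 1 ≤ b → Coprime a b →
      Σmd m d (a * b) ≡ Σmd m d a * Σmd m d b))
  × ((N : ℕ) → 1 ≤ N →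
    (∣ + d ℤ.- + (m / d) ∣ ≡ 0 →
      (ℚ.∣ (Σnew m d N ℚ./ 1) ∣ ℚ.* (π₂ N ℚ.* π₂ N)) ℚ.* (ℚ.∣ (Σnew m d N ℚ./ 1) ∣ ℚ.* (π₂ N ℚ.* π₂ N))
        ℚ.≤ (+ N ℚ./ 1))
    × (∣ + d ℤ.- + (m / d) ∣ ≢ 0 →
      ∣ Σnew m d N ∣ ≤ ∣ + d ℤ.- + (m / d) ∣ * 4 ^ ω ∣ + d ℤ.- + (m / d) ∣))
lemma3p5 m d _ _ = (Σmd-1 m d , Σmd-multiplicative m d) , λ N 1≤N → h≡0-bound N 1≤N , h≢0-bound N 1≤N
  where
  h : ℕ
  h = ∣d-m/d∣ m d
  h≡0-bound : ∀ N → 1 ≤ N → h ≡ 0 →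
    (ℚ.∣ Σnew m d N ℚ./ 1 ∣ ℚ.* (π₂ N ℚ.* π₂ N)) ℚ.* (ℚ.∣ Σnew m d N ℚ./ 1 ∣ ℚ.* (π₂ N ℚ.* π₂ N)) ℚ.≤ fromℕ N
  h≡0-bound N 1≤N h≡0 = subst (λ q → (q ℚ.* (π₂ N ℚ.* π₂ N)) ℚ.* (q ℚ.* (π₂ N ℚ.* π₂ N)) ℚ.≤ fromℕ N)
    (sym (∣z/1∣≡fromℕ∣z∣ (Σnew m d N)))
    (ℕ-bound⇒ℚ-bound ∣ Σnew m d N ∣ N (φ N) (π₂ N) (φ[n]≥1 1≤N) (π₂*φ≡id N 1≤N) (∣Σnew∣²*n³≤φ⁴ m d h≡0 N 1≤N))
  h≢0-bound : ∀ N → 1 ≤ N → h ≢ 0 → ∣ Σnew m d N ∣ ≤ h * 4 ^ ω h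
  h≢0-bound N 1≤N h≢0 = begin
    ∣ Σnew m d N ∣   ≤⟨ ∣Σnew∣≤gcd m d N 1≤N ⟩
    gcd N h          ≤⟨ gcd[m,n]≤n N h {{≢-nonZero h≢0}} ⟩
    h                ≤⟨ m≤m*n h (4 ^ ω h) {{m^n≢0 4 (ω h)}} ⟩
    h * 4 ^ ω h      ∎
    where open ≤-Reasoning
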